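{- Let $k\ge1$ be an integer. Define \[ C=\sum_{n=0}^{\infty}(6n+4)q^{3n^2+(6k+1)n+2k}(q^{4n+4k+2}-1)+4\sum_{n=0}^{\infty}q^{3n^2+(6k+1)n+4n+6k+2}, \] \[ C_1=\sum_{j=0}^{\infty}\frac{q^{8kj+8k+4j^2+6j+2}}{(-q^{2k+2};q^2)_{2j+2}}\left(1-q^{4k+4j+4}\right)\sum_{i=1}^{2j+1}\frac{q^{2i}}{1+q^{2i+2k}}, \] \[ C_2=\sum_{j=0}^{\infty}\frac{q^{8kj+8k+4j^2+6j+2}}{(-q^{2k+2};q^2)_{2j+2}}\,q^{2k+4j+4}\sum_{i=2}^{2j+1}\frac{q^{2i}}{1+q^{2i+2k}}, \] \[ C_3=\sum_{j=0}^{\infty}\frac{q^{8kj+8k+4j^2+6j+2}}{(-q^{2k+2};q^2)_{2j+2}}\,q^{2k+4j+4}\left(\frac{q^{2}}{1+q^{2k+2}}-\frac{q^{2k+4j+4}}{1+q^{2k+4j+4}}\right), \] \[ C_4=\sum_{n=0}^{\infty}\frac{(-1)^n(2n+2)q^{4kn+2k+n^2+n}}{(-q^{2k+2};q^2)_n}. \] Then $-C=2(C_1+C_2+C_3+C_4)$.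
   Context: $(x;q)_n=\prod_{j=1}^{n}(1-xq^{j-1})$ (with $(x;q)_0=1$). Identities are of formal power series in $q$. -}

module Defs where

open import Data.Nat using (ℕ; zero; suc; _∸_; _≡ᵇ_)
open import Data.Integer as ℤ using (ℤ; +_; -_; _+_; _*_; _-_)
open import Data.Bool using (if_then_else_)
open import Relation.Binary.PropositionalEquality using (_≡_)

-- Formal power series in q with integer coefficients: coefficient sequences.
PS : Set
PS = ℕ → ℤ

_≈_ : PS → PS → Set
f ≈ g = ∀ n → f n ≡ g n
infix 4 _≈_

sumℤ : ℕ → (ℕ → ℤ) → ℤ
sumℤ zero    a = + 0
sumℤ (suc n) a = sumℤ n a + a n

cst : ℤ → PS
cst c zero    = c
cst c (suc n) = + 0

0ₛ 1ₛ : PS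
0ₛ = cst (+ 0)
1ₛ = cst (+ 1)

q^ : ℕ → PS
q^ e n = if n ≡ᵇ e then + 1 else + 0

_⊕_ : PS → PS → PS
(f ⊕ g) n = f n + g n
infixl 6 _⊕_

⊝_ : PS → PS
(⊝ f) n = - (f n)

_⊖_ : PS → PS → PS
f ⊖ g = f ⊕ (⊝ g)
infixl 6 _⊖_

_·_ : ℤ → PS → PS
(c · f) n = c * f n
infixr 8 _·_

_⊗_ : PS → PS → PS
(f ⊗ g) n = sumℤ (suc n) (λ i → f i * g (n ∸ i))
infixl 7 _⊗_

_^ₛ_ : PS → ℕ → PS
f ^ₛ zero    = 1ₛ
f ^ₛ suc t   = f ⊗ (f ^ₛ t)

Σfin : ℕ → (ℕ → PS) → PS
Σfin n F m = sumℤ n (λ t → F t m)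

Πfin : ℕ → (ℕ → PS) → PS
Πfin zero    F = 1ₛ
Πfin (suc n) F = Πfin n F ⊗ F n

-- Infinite sum Σ_{j ≥ 0} F j of series, for families where F j has
-- q-adic valuation ≥ j (so it converges formally): the coefficient of q^N
-- only receives contributions from j ≤ N.
Σ∞ : (ℕ → PS) → PS
Σ∞ F N = sumℤ (suc N) (λ j → F j N)

-- Multiplicative inverse of a series with constant term 1:
-- 1/f = Σ_{t ≥ 0} (1 - f)^t  ((1-f)^t has valuation ≥ t).
inv : PS → PS
inv f = Σ∞ (λ t → (1ₛ ⊖ f) ^ₛ t)

-- q-Pochhammer symbol with general base:  (x; b)_n = Π_{j<n} (1 - x b^j).
-- With b = q^d this is (x; q^d)_n.
poch : PS → PS → ℕ → PS
poch x b n = Πfin n (λ j → 1ₛ ⊖ x ⊗ (b ^ₛ j))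

ι : ℕ → ℤ
ι = +_

sgn : ℕ → ℤ
sgn n = (ℤ.-[1+ 0 ]) ℤ.^ n

open Data.Nat using () renaming (_+_ to _+ₙ_; _*_ to _*ₙ_)

invPoch : ℕ → ℕ → PS
invPoch k n = inv (poch (⊝ q^ (2 *ₙ k +ₙ 2)) (q^ 2) n)

C : ℕ → PS
C k = Σ∞ (λ n → ι (6 *ₙ n +ₙ 4) · (q^ (3 *ₙ n *ₙ n +ₙ (6 *ₙ k +ₙ 1) *ₙ n +ₙ 2 *ₙ k)
                                    ⊗ (q^ (4 *ₙ n +ₙ 4 *ₙ k +ₙ 2) ⊖ 1ₛ)))
    ⊕ ι 4 · Σ∞ (λ n → q^ (3 *ₙ n *ₙ n +ₙ (6 *ₙ k +ₙ 1) *ₙ n +ₙ 4 *ₙ n +ₙ 6 *ₙ k +ₙ 2))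

common : ℕ → ℕ → PS
common k j = q^ (8 *ₙ k *ₙ j +ₙ 8 *ₙ k +ₙ 4 *ₙ j *ₙ j +ₙ 6 *ₙ j +ₙ 2)
             ⊗ invPoch k (2 *ₙ j +ₙ 2)

term : ℕ → ℕ → PS
term k i = q^ (2 *ₙ i) ⊗ inv (1ₛ ⊕ q^ (2 *ₙ i +ₙ 2 *ₙ k))

C₁ : ℕ → PS
C₁ k = Σ∞ (λ j → common k j ⊗ (1ₛ ⊖ q^ (4 *ₙ k +ₙ 4 *ₙ j +ₙ 4))
                 ⊗ Σfin (2 *ₙ j +ₙ 1) (λ t → term k (1 +ₙ t)))   -- i = 1 .. 2j+1

C₂ : ℕ → PS
C₂ k = Σ∞ (λ j → common k j ⊗ q^ (2 *ₙ k +ₙ 4 *ₙ j +ₙ 4)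
                 ⊗ Σfin (2 *ₙ j) (λ t → term k (2 +ₙ t)))       -- i = 2 .. 2j+1

C₃ : ℕ → PS
C₃ k = Σ∞ (λ j → common k j ⊗ q^ (2 *ₙ k +ₙ 4 *ₙ j +ₙ 4)
                 ⊗ (q^ 2 ⊗ inv (1ₛ ⊕ q^ (2 *ₙ k +ₙ 2))
                    ⊖ q^ (2 *ₙ k +ₙ 4 *ₙ j +ₙ 4) ⊗ inv (1ₛ ⊕ q^ (2 *ₙ k +ₙ 4 *ₙ j +ₙ 4))))

C₄ : ℕ → PS
C₄ k = Σ∞ (λ n → (sgn n * ι (2 *ₙ n +ₙ 2)) ·
                 (q^ (4 *ₙ k *ₙ n +ₙ 2 *ₙ k +ₙ n *ₙ n +ₙ n) ⊗ invPoch k n))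

{-# OPTIONS --safe #-}
-- Put z = q^{2k} and view every series as a function of k.  Shifting the
-- summation index by one and splitting off powers of z expresses each summand
-- at (k, n + 1) through summands at (k + 1, n), up to a telescoping difference;
-- the relations used are (-q^{2k+2};q^2)_{n+1} = (1 + q^{2k+2n+2}) (-q^{2k+2};q^2)_n,
-- its analogue for k ↦ k + 1, and the matching recursions of the inner sums
-- Σ_{i ≤ n} q^{2i}/(1 + q^{2i+2k}).  Besides C this is done for V = C₄ + Σ e, where
-- the terms n = 2j+1 and n = 2j+2 of Σ e add up to the j-th terms of C₁ + C₂ + C₃,
-- and for two auxiliary series T and U.  The inhomogeneous terms cancel in
--   (U + T)(k) = z³ (U + T)(k+1),
--   (C + 2V)(k) = z³q² (C + 2V)(k+1) + 6z² (U + T)(k+1),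
-- and since z has positive q-adic valuation when k ≥ 1, iterating these forces
-- U + T = 0 and then C + 2V = 0, that is -C = 2(C₁ + C₂ + C₃ + C₄).
module Submission where

open import Defs
open import Data.Nat using (ℕ; _≤_)
open import Data.Integer using (+_)

open import Data.Nat as ℕ using (zero; suc; _∸_; _<_; z≤n; s≤s; _≤?_; _<?_)
  renaming (_+_ to _+ₙ_; _*_ to _*ₙ_)
import Data.Nat.Properties as ℕ
open import Data.Nat.Tactic.RingSolver using (solve-∀)
open import Data.Integer as ℤ using (ℤ; -_; _+_; _*_; _-_)
import Data.Integer.Properties as ℤ
open import Data.List using (List; []; _∷_; foldl)
open import Data.Maybe using (Maybe; just; nothing)
open import Data.Product using (_,_)
open import Function using (_∘_)
open import Relation.Nullary using (Dec; yes; no; contradiction)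
open import Relation.Binary.PropositionalEquality
  using (_≡_; _≢_; refl; sym; trans; cong; cong₂; subst; module ≡-Reasoning)
open import Relation.Binary.Bundles using (Setoid)
open import Relation.Binary.Structures using (IsEquivalence)
open import Algebra.Bundles using (CommutativeRing)
open import Algebra.Structures using (IsCommutativeRing)
open import Algebra.Solver.Ring.AlmostCommutativeRing
  using (fromCommutativeRing; _-Raw-AlmostCommutative⟶_)
import Algebra.Solver.Ring as RingSolver
import Relation.Binary.Reasoning.Setoid as SetoidReasoning

sumℤ-cong-< : ∀ n {a b : ℕ → ℤ} → (∀ i → i < n → a i ≡ b i) → sumℤ n a ≡ sumℤ n b
sumℤ-cong-< zero    a≡b = refl
sumℤ-cong-< (suc n) a≡b =
  cong₂ _+_ (sumℤ-cong-< n (λ i i<n → a≡b i (ℕ.m<n⇒m<1+n i<n))) (a≡b n (ℕ.n<1+n n))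

sumℤ-cong : ∀ n {a b : ℕ → ℤ} → (∀ i → a i ≡ b i) → sumℤ n a ≡ sumℤ n b
sumℤ-cong n a≡b = sumℤ-cong-< n (λ i _ → a≡b i)

sumℤ-zero : ∀ n {a : ℕ → ℤ} → (∀ i → i < n → a i ≡ + 0) → sumℤ n a ≡ + 0
sumℤ-zero zero    a≡0 = refl
sumℤ-zero (suc n) a≡0 =
  cong₂ _+_ (sumℤ-zero n (λ i i<n → a≡0 i (ℕ.m<n⇒m<1+n i<n))) (a≡0 n (ℕ.n<1+n n))

sumℤ-+ : ∀ n (a b : ℕ → ℤ) → sumℤ n (λ i → a i + b i) ≡ sumℤ n a + sumℤ n b
sumℤ-+ zero    a b = refl
sumℤ-+ (suc n) a b = begin
  sumℤ n (λ i → a i + b i) + (a n + b n)  ≡⟨ cong (_+ (a n + b n)) (sumℤ-+ n a b) ⟩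
  (sumℤ n a + sumℤ n b) + (a n + b n)     ≡⟨ ℤ.+-assoc (sumℤ n a) (sumℤ n b) (a n + b n) ⟩
  sumℤ n a + (sumℤ n b + (a n + b n))     ≡⟨ cong (λ x → sumℤ n a + x) (ℤ.+-comm (sumℤ n b) (a n + b n)) ⟩
  sumℤ n a + ((a n + b n) + sumℤ n b)     ≡⟨ cong (λ x → sumℤ n a + x) (ℤ.+-assoc (a n) (b n) (sumℤ n b)) ⟩
  sumℤ n a + (a n + (b n + sumℤ n b))     ≡⟨ sym (ℤ.+-assoc (sumℤ n a) (a n) (b n + sumℤ n b)) ⟩
  (sumℤ n a + a n) + (b n + sumℤ n b)     ≡⟨ cong (λ x → sumℤ (suc n) a + x) (ℤ.+-comm (b n) (sumℤ n b)) ⟩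
  sumℤ (suc n) a + sumℤ (suc n) b         ∎
  where open ≡-Reasoning

sumℤ-*ˡ : ∀ n c (a : ℕ → ℤ) → sumℤ n (λ i → c * a i) ≡ c * sumℤ n a
sumℤ-*ˡ zero    c a = sym (ℤ.*-zeroʳ c)
sumℤ-*ˡ (suc n) c a =
  trans (cong (_+ (c * a n)) (sumℤ-*ˡ n c a)) (sym (ℤ.*-distribˡ-+ c (sumℤ n a) (a n)))

sumℤ-*ʳ : ∀ n c (a : ℕ → ℤ) → sumℤ n (λ i → a i * c) ≡ sumℤ n a * c
sumℤ-*ʳ n c a = trans (sumℤ-cong n (λ i → ℤ.*-comm (a i) c))
                      (trans (sumℤ-*ˡ n c a) (ℤ.*-comm c (sumℤ n a)))

sumℤ-head : ∀ n (a : ℕ → ℤ) → sumℤ (suc n) a ≡ a 0 + sumℤ n (a ∘ suc)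
sumℤ-head zero    a = trans (ℤ.+-identityˡ (a 0)) (sym (ℤ.+-identityʳ (a 0)))
sumℤ-head (suc n) a = trans (cong (_+ a (suc n)) (sumℤ-head n a))
                            (ℤ.+-assoc (a 0) (sumℤ n (a ∘ suc)) (a (suc n)))

sumℤ-comm : ∀ n m (a : ℕ → ℕ → ℤ) →
  sumℤ n (λ i → sumℤ m (a i)) ≡ sumℤ m (λ j → sumℤ n (λ i → a i j))
sumℤ-comm zero    m a = sym (sumℤ-zero m (λ _ _ → refl))
sumℤ-comm (suc n) m a = trans (cong (_+ sumℤ m (a n)) (sumℤ-comm n m a))
                              (sym (sumℤ-+ m (λ j → sumℤ n (λ i → a i j)) (a n)))

sumℤ-reverse : ∀ n (a : ℕ → ℤ) → sumℤ (suc n) a ≡ sumℤ (suc n) (λ i → a (n ∸ i))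
sumℤ-reverse zero    a = refl
sumℤ-reverse (suc n) a = begin
  sumℤ (suc n) a + a (suc n)                   ≡⟨ cong (_+ a (suc n)) (sumℤ-reverse n a) ⟩
  sumℤ (suc n) (λ i → a (n ∸ i)) + a (suc n)   ≡⟨ ℤ.+-comm _ (a (suc n)) ⟩
  a (suc n) + sumℤ (suc n) (λ i → a (n ∸ i))   ≡⟨ sym (sumℤ-head (suc n) (λ i → a (suc n ∸ i))) ⟩
  sumℤ (suc (suc n)) (λ i → a (suc n ∸ i))     ∎
  where open ≡-Reasoning

sumℤ-telescope : ∀ n (g : ℕ → ℤ) → sumℤ n (λ i → g i - g (suc i)) ≡ g 0 - g n
sumℤ-telescope zero    g = sym (ℤ.+-inverseʳ (g 0))
sumℤ-telescope (suc n) g = begin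
  sumℤ n (λ i → g i - g (suc i)) + (g n - g (suc n))
    ≡⟨ cong (_+ (g n - g (suc n))) (sumℤ-telescope n g) ⟩
  (g 0 - g n) + (g n - g (suc n))    ≡⟨ ℤ.+-assoc (g 0) (- g n) (g n - g (suc n)) ⟩
  g 0 + (- g n + (g n - g (suc n)))  ≡⟨ cong (λ x → g 0 + x) (sym (ℤ.+-assoc (- g n) (g n) (- g (suc n)))) ⟩
  g 0 + ((- g n + g n) - g (suc n))  ≡⟨ cong (λ x → g 0 + (x - g (suc n))) (ℤ.+-inverseˡ (g n)) ⟩
  g 0 + (+ 0 - g (suc n))            ≡⟨ cong (λ x → g 0 + x) (ℤ.+-identityˡ (- g (suc n))) ⟩
  g 0 - g (suc n)                    ∎
  where open ≡-Reasoning

sumℤ-pad : ∀ {m n} (a : ℕ → ℤ) → m ≤ n → (∀ i → m ≤ i → a i ≡ + 0) → sumℤ n a ≡ sumℤ m a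
sumℤ-pad {m} {n} a m≤n a≡0 =
  trans (cong (λ t → sumℤ t a) (sym (ℕ.m∸n+n≡m m≤n))) (go (n ∸ m))
  where
  go : ∀ d → sumℤ (d +ₙ m) a ≡ sumℤ m a
  go zero    = refl
  go (suc d) = trans (cong₂ _+_ (go d) (a≡0 (d +ₙ m) (ℕ.m≤n+m m d))) (ℤ.+-identityʳ (sumℤ m a))

guard : ℕ → ℕ → ℤ → ℤ
guard i m x with i ≤? m
... | yes _ = x
... | no  _ = + 0

guard-yes : ∀ {i m} x → i ≤ m → guard i m x ≡ x
guard-yes {i} {m} x i≤m with i ≤? m
... | yes _   = refl
... | no  i≰m = contradiction i≤m i≰m

guard-no : ∀ {i m} x → m < i → guard i m x ≡ + 0
guard-no {i} {m} x m<i with i ≤? m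
... | yes i≤m = contradiction i≤m (ℕ.<⇒≱ m<i)
... | no  _   = refl

guard-cong : ∀ {i m x y} → (i ≤ m → x ≡ y) → guard i m x ≡ guard i m y
guard-cong {i} {m} x≡y with i ≤? m
... | yes i≤m = x≡y i≤m
... | no  _   = refl

guard-*ˡ : ∀ i m c x → guard i m (c * x) ≡ c * guard i m x
guard-*ˡ i m c x with i ≤? m
... | yes _ = refl
... | no  _ = sym (ℤ.*-zeroʳ c)

sumℤ-guard-shift : ∀ i L (b : ℕ → ℤ) → sumℤ (i +ₙ L) (λ m → guard i m (b (m ∸ i))) ≡ sumℤ L b
sumℤ-guard-shift i zero b =
  trans (cong (λ t → sumℤ t (λ m → guard i m (b (m ∸ i)))) (ℕ.+-identityʳ i))
        (sumℤ-zero i (λ m m<i → guard-no _ m<i))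
sumℤ-guard-shift i (suc L) b =
  trans (cong (λ t → sumℤ t (λ m → guard i m (b (m ∸ i)))) (ℕ.+-suc i L))
        (cong₂ _+_ (sumℤ-guard-shift i L b)
                   (trans (guard-yes _ (ℕ.m≤m+n i L)) (cong b (ℕ.m+n∸m≡n i L))))

sumℤ-guard-truncate : ∀ {m N} (x : ℕ → ℤ) → m ≤ N →
  sumℤ (suc N) (λ i → guard i m (x i)) ≡ sumℤ (suc m) x
sumℤ-guard-truncate {m} x m≤N =
  trans (sumℤ-pad _ (s≤s m≤N) (λ i m<i → guard-no _ m<i))
        (sumℤ-cong-< (suc m) (λ i i≤m → guard-yes _ (ℕ.≤-pred i≤m)))

-- Formal power series as a commutative ring

cst-0 : ∀ i → cst (+ 0) i ≡ + 0
cst-0 zero    = refl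
cst-0 (suc i) = refl

⊕-cong : ∀ {f f′ g g′} → f ≈ f′ → g ≈ g′ → f ⊕ g ≈ f′ ⊕ g′
⊕-cong f≈f′ g≈g′ n = cong₂ _+_ (f≈f′ n) (g≈g′ n)

⊝-cong : ∀ {f f′} → f ≈ f′ → ⊝ f ≈ ⊝ f′
⊝-cong f≈f′ n = cong -_ (f≈f′ n)

⊗-cong : ∀ {f f′ g g′} → f ≈ f′ → g ≈ g′ → f ⊗ g ≈ f′ ⊗ g′
⊗-cong f≈f′ g≈g′ n = sumℤ-cong (suc n) (λ i → cong₂ _*_ (f≈f′ i) (g≈g′ (n ∸ i)))

⊗-comm : ∀ f g → f ⊗ g ≈ g ⊗ f
⊗-comm f g n = trans (sumℤ-reverse n (λ i → f i * g (n ∸ i)))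
  (sumℤ-cong-< (suc n) (λ i i<1+n →
    trans (cong (λ t → f (n ∸ i) * g t) (ℕ.m∸[m∸n]≡n (ℕ.≤-pred i<1+n))) (ℤ.*-comm (f (n ∸ i)) (g i))))

⊗-distribʳ : ∀ f g h → (g ⊕ h) ⊗ f ≈ (g ⊗ f) ⊕ (h ⊗ f)
⊗-distribʳ f g h n = trans (sumℤ-cong (suc n) (λ i → ℤ.*-distribʳ-+ (f (n ∸ i)) (g i) (h i)))
                           (sumℤ-+ (suc n) _ _)

⊗-identityˡ : ∀ f → 1ₛ ⊗ f ≈ f
⊗-identityˡ f n = trans (sumℤ-head n (λ i → cst (+ 1) i * f (n ∸ i)))
  (trans (cong₂ _+_ (ℤ.*-identityˡ (f n)) (sumℤ-zero n (λ i _ → ℤ.*-zeroˡ (f (n ∸ suc i)))))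
         (ℤ.+-identityʳ (f n)))

⊗-assoc : ∀ f g h → (f ⊗ g) ⊗ h ≈ f ⊗ (g ⊗ h)
⊗-assoc f g h N = begin
    sumℤ (suc N) (λ m → sumℤ (suc m) (λ i → f i * g (m ∸ i)) * h (N ∸ m))
  ≡⟨ sumℤ-cong (suc N) (λ m → sym (sumℤ-*ʳ (suc m) (h (N ∸ m)) (λ i → f i * g (m ∸ i)))) ⟩
    sumℤ (suc N) (λ m → sumℤ (suc m) (λ i → f i * g (m ∸ i) * h (N ∸ m)))
  ≡⟨ sumℤ-cong-< (suc N) (λ m m<1+N → sym (sumℤ-guard-truncate _ (ℕ.≤-pred m<1+N))) ⟩
    sumℤ (suc N) (λ m → sumℤ (suc N) (λ i → guard i m (f i * g (m ∸ i) * h (N ∸ m))))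
  ≡⟨ sumℤ-comm (suc N) (suc N) _ ⟩
    sumℤ (suc N) (λ i → sumℤ (suc N) (λ m → guard i m (f i * g (m ∸ i) * h (N ∸ m))))
  ≡⟨ sumℤ-cong-< (suc N) (λ i i<1+N → inner i (ℕ.≤-pred i<1+N)) ⟩
    sumℤ (suc N) (λ i → f i * (g ⊗ h) (N ∸ i))
  ∎
  where
  open ≡-Reasoning
  inner : ∀ i → i ≤ N →
    sumℤ (suc N) (λ m → guard i m (f i * g (m ∸ i) * h (N ∸ m))) ≡ f i * (g ⊗ h) (N ∸ i)
  inner i i≤N = begin
      sumℤ (suc N) (λ m → guard i m (f i * g (m ∸ i) * h (N ∸ m)))
    ≡⟨ sumℤ-cong (suc N) (λ m → trans (guard-cong (λ i≤m → regroup m i≤m)) (guard-*ˡ i m (f i) _)) ⟩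
      sumℤ (suc N) (λ m → f i * guard i m (g (m ∸ i) * h ((N ∸ i) ∸ (m ∸ i))))
    ≡⟨ sumℤ-*ˡ (suc N) (f i) _ ⟩
      f i * sumℤ (suc N) (λ m → guard i m (g (m ∸ i) * h ((N ∸ i) ∸ (m ∸ i))))
    ≡⟨ cong (λ t → f i * sumℤ t (λ m → guard i m (g (m ∸ i) * h ((N ∸ i) ∸ (m ∸ i)))))
            (sym (trans (ℕ.+-suc i (N ∸ i)) (cong suc (ℕ.m+[n∸m]≡n i≤N)))) ⟩
      f i * sumℤ (i +ₙ suc (N ∸ i)) (λ m → guard i m (g (m ∸ i) * h ((N ∸ i) ∸ (m ∸ i))))
    ≡⟨ cong (f i *_) (sumℤ-guard-shift i (suc (N ∸ i)) (λ j → g j * h ((N ∸ i) ∸ j))) ⟩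
      f i * (g ⊗ h) (N ∸ i)
    ∎
    where
    regroup : ∀ m → i ≤ m → f i * g (m ∸ i) * h (N ∸ m) ≡ f i * (g (m ∸ i) * h ((N ∸ i) ∸ (m ∸ i)))
    regroup m i≤m = trans (ℤ.*-assoc (f i) (g (m ∸ i)) (h (N ∸ m)))
      (cong (λ t → f i * (g (m ∸ i) * h t))
            (trans (cong (N ∸_) (sym (ℕ.m+[n∸m]≡n i≤m))) (sym (ℕ.∸-+-assoc N i (m ∸ i)))))

-- Opaque copies of the ring operations: the ring solver closes its goals by
-- reflexivity, which must compare expressions syntactically rather than
-- unfold them into coefficient sums.
opaque
  infixl 6 _⊕′_
  infixl 7 _⊗′_
  infix  8 ⊝′_

  _⊕′_ _⊗′_ : PS → PS → PS
  _⊕′_ = _⊕_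
  _⊗′_ = _⊗_

  ⊝′_ : PS → PS
  ⊝′_ = ⊝_

infixl 6 _⊖′_
_⊖′_ : PS → PS → PS
f ⊖′ g = f ⊕′ ⊝′ g

≈-isEquivalence : IsEquivalence _≈_
≈-isEquivalence = record
  { refl  = λ _ → refl
  ; sym   = λ f≈g n → sym (f≈g n)
  ; trans = λ f≈g g≈h n → trans (f≈g n) (g≈h n)
  }

PS-setoid : Setoid _ _
PS-setoid = record { isEquivalence = ≈-isEquivalence }

open Setoid PS-setoid using () renaming (refl to ≈-refl; sym to ≈-sym; trans to ≈-trans)

module ≈-Reasoning = SetoidReasoning PS-setoid

opaque
  unfolding _⊕′_ _⊗′_ ⊝′_

  PS-isCommutativeRing : IsCommutativeRing _≈_ _⊕′_ _⊗′_ ⊝′_ 0ₛ 1ₛ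
  PS-isCommutativeRing = record
    { isRing = record
      { +-isAbelianGroup = record
        { isGroup = record
          { isMonoid = record
            { isSemigroup = record
              { isMagma = record { isEquivalence = ≈-isEquivalence ; ∙-cong = ⊕-cong }
              ; assoc = λ f g h n → ℤ.+-assoc (f n) (g n) (h n) }
            ; identity = (λ f n → trans (cong (_+ f n) (cst-0 n)) (ℤ.+-identityˡ (f n)))
                       , (λ f n → trans (cong (λ x → f n + x) (cst-0 n)) (ℤ.+-identityʳ (f n))) }
          ; inverse = (λ f n → trans (ℤ.+-inverseˡ (f n)) (sym (cst-0 n)))
                    , (λ f n → trans (ℤ.+-inverseʳ (f n)) (sym (cst-0 n)))
          ; ⁻¹-cong = ⊝-cong }
        ; comm = λ f g n → ℤ.+-comm (f n) (g n) }
      ; *-cong = ⊗-cong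
      ; *-assoc = ⊗-assoc
      ; *-identity = ⊗-identityˡ , λ f → ≈-trans (⊗-comm f 1ₛ) (⊗-identityˡ f)
      ; distrib = (λ f g h → ≈-trans (⊗-comm f (g ⊕ h))
                               (≈-trans (⊗-distribʳ f g h) (⊕-cong (⊗-comm g f) (⊗-comm h f))))
                , ⊗-distribʳ }
    ; *-comm = ⊗-comm }

  ⊕′≈⊕ : ∀ f g → f ⊕′ g ≈ f ⊕ g
  ⊕′≈⊕ f g = ≈-refl

  ⊗′≈⊗ : ∀ f g → f ⊗′ g ≈ f ⊗ g
  ⊗′≈⊗ f g = ≈-refl

  ⊝′≈⊝ : ∀ f → ⊝′ f ≈ ⊝ f
  ⊝′≈⊝ f = ≈-refl

  ⊖′≈⊖ : ∀ f g → f ⊖′ g ≈ f ⊖ g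
  ⊖′≈⊖ f g = ≈-refl

  ·≈cst⊗′ : ∀ c f → c · f ≈ cst c ⊗′ f
  ·≈cst⊗′ c f n = sym (trans (sumℤ-head n (λ i → cst c i * f (n ∸ i)))
    (trans (cong (λ x → c * f n + x) (sumℤ-zero n (λ i _ → ℤ.*-zeroˡ (f (n ∸ suc i))))) (ℤ.+-identityʳ _)))

  cst-homo-+ : ∀ a b → cst (a + b) ≈ cst a ⊕′ cst b
  cst-homo-+ a b zero    = refl
  cst-homo-+ a b (suc n) = refl

  cst-homo-neg : ∀ a → cst (- a) ≈ ⊝′ cst a
  cst-homo-neg a zero    = refl
  cst-homo-neg a (suc n) = refl

  cst-homo-* : ∀ a b → cst (a * b) ≈ cst a ⊗′ cst b
  cst-homo-* a b zero    = ·≈cst⊗′ a (cst b) zero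
  cst-homo-* a b (suc n) = trans (sym (ℤ.*-zeroʳ a)) (·≈cst⊗′ a (cst b) (suc n))

PS-commutativeRing : CommutativeRing _ _
PS-commutativeRing = record { isCommutativeRing = PS-isCommutativeRing }

cst-homomorphism : ℤ.+-*-rawRing -Raw-AlmostCommutative⟶ fromCommutativeRing PS-commutativeRing
cst-homomorphism = record
  { ⟦_⟧ = cst ; +-homo = cst-homo-+ ; *-homo = cst-homo-* ; -‿homo = cst-homo-neg
  ; 0-homo = ≈-refl ; 1-homo = ≈-refl }

cst-≟ : ∀ a b → Maybe (cst a ≈ cst b)
cst-≟ a b with a ℤ.≟ b
... | yes refl = just ≈-refl
... | no  _    = nothing

open RingSolver ℤ.+-*-rawRing (fromCommutativeRing PS-commutativeRing) cst-homomorphism cst-≟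
  using (solve; _:+_; _:*_; :-_; _:-_; _:=_; con)

open CommutativeRing PS-commutativeRing using ()
  renaming (+-cong to ⊕′-cong; *-cong to ⊗′-cong; -‿cong to ⊝′-cong)

⊕-cong′ : ∀ {f f′ g g′} → f ≈ f′ → g ≈ g′ → f ⊕ g ≈ f′ ⊕′ g′
⊕-cong′ f≈f′ g≈g′ = ≈-trans (⊕-cong f≈f′ g≈g′) (≈-sym (⊕′≈⊕ _ _))

⊗-cong′ : ∀ {f f′ g g′} → f ≈ f′ → g ≈ g′ → f ⊗ g ≈ f′ ⊗′ g′
⊗-cong′ f≈f′ g≈g′ = ≈-trans (⊗-cong f≈f′ g≈g′) (≈-sym (⊗′≈⊗ _ _))

⊖-cong′ : ∀ {f f′ g g′} → f ≈ f′ → g ≈ g′ → f ⊖ g ≈ f′ ⊖′ g′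
⊖-cong′ f≈f′ g≈g′ = ≈-trans (⊕-cong f≈f′ (⊝-cong g≈g′)) (≈-sym (⊖′≈⊖ _ _))

⊖′-cong : ∀ {f f′ g g′} → f ≈ f′ → g ≈ g′ → f ⊖′ g ≈ f′ ⊖′ g′
⊖′-cong f≈f′ g≈g′ = ⊕′-cong f≈f′ (⊝′-cong g≈g′)

≈-mod : ∀ {l r c a b} → l ≈ r ⊕′ c ⊗′ (a ⊖′ b) → a ≈ b → l ≈ r
≈-mod {l} {r} {c} {a} {b} l≈r+c[a-b] a≈b = begin
  l                     ≈⟨ l≈r+c[a-b] ⟩
  r ⊕′ c ⊗′ (a ⊖′ b)    ≈⟨ ⊕′-cong (≈-refl {r}) (⊗′-cong (≈-refl {c}) (⊖′-cong a≈b (≈-refl {b}))) ⟩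
  r ⊕′ c ⊗′ (b ⊖′ b)    ≈⟨ solve 3 (λ r c b → r :+ c :* (b :- b) := r) ≈-refl r c b ⟩
  r                     ∎
  where open ≈-Reasoning

≡⇒≈ : ∀ {f g} → f ≡ g → f ≈ g
≡⇒≈ refl = ≈-refl

cst-cong : ∀ {a b} → a ≡ b → cst a ≈ cst b
cst-cong refl = ≈-refl

·-cong : ∀ c {f g} → f ≈ g → c · f ≈ c · g
·-cong c f≈g n = cong (c *_) (f≈g n)

cst-ι-affine : ∀ {m} a n b → m ≡ a *ₙ n +ₙ b → cst (ι m) ≈ cst (+ a) ⊗′ cst (ι n) ⊕′ cst (+ b)
cst-ι-affine a n b refl = begin
  cst (ι (a *ₙ n +ₙ b))          ≈⟨ cst-cong (trans (ℤ.pos-+ (a *ₙ n) b) (cong (_+ + b) (ℤ.pos-* a n))) ⟩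
  cst (+ a * + n + + b)          ≈⟨ cst-homo-+ (+ a * + n) (+ b) ⟩
  cst (+ a * + n) ⊕′ cst (+ b)   ≈⟨ ⊕′-cong (cst-homo-* (+ a) (+ n)) (≈-refl {cst (+ b)}) ⟩
  cst (+ a) ⊗′ cst (+ n) ⊕′ cst (+ b) ∎
  where open ≈-Reasoning

·-* : ∀ x y f → (x * y) · f ≈ cst x ⊗′ (cst y ⊗′ f)
·-* x y f = begin
  (x * y) · f                ≈⟨ ·≈cst⊗′ (x * y) f ⟩
  cst (x * y) ⊗′ f           ≈⟨ ⊗′-cong (cst-homo-* x y) (≈-refl {f}) ⟩
  cst x ⊗′ cst y ⊗′ f        ≈⟨ solve 3 (λ x y f → x :* y :* f := x :* (y :* f)) ≈-refl (cst x) (cst y) f ⟩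
  cst x ⊗′ (cst y ⊗′ f)      ∎
  where open ≈-Reasoning

cst-sgn-suc : ∀ n → cst (sgn (suc n)) ≈ ⊝′ cst (sgn n)
cst-sgn-suc n = ≈-trans (cst-cong (ℤ.-1*i≡-i (sgn n))) (cst-homo-neg (sgn n))

sgn-suc-suc : ∀ n → sgn (suc (suc n)) ≡ sgn n
sgn-suc-suc n = trans (ℤ.-1*i≡-i (ℤ.-[1+ 0 ] * sgn n))
                      (trans (cong -_ (ℤ.-1*i≡-i (sgn n))) (ℤ.neg-involutive (sgn n)))

sgn-even : ∀ j → sgn (2 *ₙ j) ≡ + 1
sgn-even j = trans (sym (ℤ.^-*-assoc ℤ.-[1+ 0 ] 2 j)) (ℤ.^-zeroˡ j)

q^-refl : ∀ a → q^ a a ≡ + 1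
q^-refl zero    = refl
q^-refl (suc a) = q^-refl a

q^-≢ : ∀ {a n} → n ≢ a → q^ a n ≡ + 0
q^-≢ {zero}  {zero}  n≢a = contradiction refl n≢a
q^-≢ {suc a} {zero}  n≢a = refl
q^-≢ {zero}  {suc n} n≢a = refl
q^-≢ {suc a} {suc n} n≢a = q^-≢ {a} {n} (n≢a ∘ cong suc)

sumℤ-q^-* : ∀ a L (x : ℕ → ℤ) → sumℤ L (λ i → q^ a i * x i) ≡ guard (suc a) L (x a)
sumℤ-q^-* a zero    x = sym (guard-no {suc a} {0} (x a) (s≤s z≤n))
sumℤ-q^-* a (suc L) x with L ℕ.≟ a
... | yes refl = trans (cong₂ _+_ (trans (sumℤ-q^-* L L x) (guard-no _ (ℕ.n<1+n L)))
                                  (trans (cong (_* x L) (q^-refl L)) (ℤ.*-identityˡ (x L))))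
                       (trans (ℤ.+-identityˡ (x L)) (sym (guard-yes _ ℕ.≤-refl)))
... | no  L≢a  = trans (cong₂ _+_ (sumℤ-q^-* a L x) (trans (cong (_* x L) (q^-≢ L≢a)) (ℤ.*-zeroˡ (x L))))
                       (trans (ℤ.+-identityʳ _) (extend (suc a ≤? L)))
  where
  extend : Dec (suc a ≤ L) → guard (suc a) L (x a) ≡ guard (suc a) (suc L) (x a)
  extend (yes a<L) = trans (guard-yes _ a<L) (sym (guard-yes _ (ℕ.m≤n⇒m≤1+n a<L)))
  extend (no  a≮L) = trans (guard-no _ (ℕ.≰⇒> a≮L))
    (sym (guard-no _ (s≤s (ℕ.≤∧≢⇒< (ℕ.≤-pred (ℕ.≰⇒> a≮L)) L≢a))))

q^-⊗-at : ∀ a f N → (q^ a ⊗ f) N ≡ guard a N (f (N ∸ a))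
q^-⊗-at a f N = trans (sumℤ-q^-* a (suc N) (λ i → f (N ∸ i))) (lower (a ≤? N))
  where
  lower : Dec (a ≤ N) → guard (suc a) (suc N) (f (N ∸ a)) ≡ guard a N (f (N ∸ a))
  lower (yes a≤N) = trans (guard-yes _ (s≤s a≤N)) (sym (guard-yes _ a≤N))
  lower (no  a≰N) = trans (guard-no _ (s≤s (ℕ.≰⇒> a≰N))) (sym (guard-no _ (ℕ.≰⇒> a≰N)))

q^-cong : ∀ {a b} → a ≡ b → q^ a ≈ q^ b
q^-cong refl = ≈-refl

q^-0 : q^ 0 ≈ 1ₛ
q^-0 zero    = refl
q^-0 (suc n) = refl

q^-+ : ∀ a b → q^ (a +ₙ b) ≈ q^ a ⊗ q^ b
q^-+ a b N = sym (trans (q^-⊗-at a (q^ b) N) (compare (a ≤? N) (N ℕ.≟ a +ₙ b)))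
  where
  compare : ∀ {N} → Dec (a ≤ N) → Dec (N ≡ a +ₙ b) → guard a N (q^ b (N ∸ a)) ≡ q^ (a +ₙ b) N
  compare (yes a≤N) (yes refl) =
    trans (guard-yes _ a≤N) (trans (cong (q^ b) (ℕ.m+n∸m≡n a b)) (trans (q^-refl b) (sym (q^-refl (a +ₙ b)))))
  compare (yes a≤N) (no N≢a+b) = trans (guard-yes _ a≤N)
    (trans (q^-≢ (λ e → N≢a+b (trans (sym (ℕ.m+[n∸m]≡n a≤N)) (cong (a +ₙ_) e)))) (sym (q^-≢ N≢a+b)))
  compare (no a≰N) _ = trans (guard-no _ (ℕ.≰⇒> a≰N))
    (sym (q^-≢ (λ e → a≰N (subst (a ≤_) (sym e) (ℕ.m≤m+n a b)))))

q^-+′ : ∀ a b → q^ (a +ₙ b) ≈ q^ a ⊗′ q^ b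
q^-+′ a b = ≈-trans (q^-+ a b) (≈-sym (⊗′≈⊗ _ _))

q^-^ₛ : ∀ a t → q^ a ^ₛ t ≈ q^ (a *ₙ t)
q^-^ₛ a zero    = ≈-trans (≈-sym q^-0) (q^-cong (sym (ℕ.*-zeroʳ a)))
q^-^ₛ a (suc t) = ≈-trans (⊗-cong (≈-refl {q^ a}) (q^-^ₛ a t))
                          (≈-trans (≈-sym (q^-+ a (a *ₙ t))) (q^-cong (sym (ℕ.*-suc a t))))

∏q^ : ℕ → List ℕ → PS
∏q^ a as = foldl (λ acc b → acc ⊗′ q^ b) (q^ a) as

q^-∑ : ∀ {e} a as → e ≡ foldl _+ₙ_ a as → q^ e ≈ ∏q^ a as
q^-∑ a as refl = ≈-sym (go as (q^ a) a ≈-refl)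
  where
  go : ∀ bs acc e → acc ≈ q^ e → foldl (λ acc b → acc ⊗′ q^ b) acc bs ≈ q^ (foldl _+ₙ_ e bs)
  go []       acc e acc≈q^e = acc≈q^e
  go (b ∷ bs) acc e acc≈q^e = go bs (acc ⊗′ q^ b) (e +ₙ b) (≈-trans (⊗′-cong acc≈q^e ≈-refl) (≈-sym (q^-+′ e b)))

infix 4 _≤ᵥ_
_≤ᵥ_ : ℕ → PS → Set
a ≤ᵥ f = ∀ n → n < a → f n ≡ + 0

-- For such families Σ∞ is the genuine formal sum.
Summable : (ℕ → PS) → Set
Summable F = ∀ j → j ≤ᵥ F j

≤ᵥ-mono : ∀ {a b f} → b ≤ a → a ≤ᵥ f → b ≤ᵥ f
≤ᵥ-mono b≤a a≤f n n<b = a≤f n (ℕ.<-≤-trans n<b b≤a)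

≤ᵥ-q^ : ∀ a → a ≤ᵥ q^ a
≤ᵥ-q^ a n n<a = q^-≢ (λ n≡a → ℕ.<-irrefl n≡a n<a)

≤ᵥ-q^-+ : ∀ {a} e b → e ≡ a +ₙ b → a ≤ᵥ q^ e
≤ᵥ-q^-+ {a} e b e≡a+b = ≤ᵥ-mono (subst (a ≤_) (sym e≡a+b) (ℕ.m≤m+n a b)) (≤ᵥ-q^ e)

≤ᵥ-· : ∀ {a} c f → a ≤ᵥ f → a ≤ᵥ c · f
≤ᵥ-· c f a≤f n n<a = trans (cong (c *_) (a≤f n n<a)) (ℤ.*-zeroʳ c)

≤ᵥ-⊗ : ∀ {a b f g} → a ≤ᵥ f → b ≤ᵥ g → a +ₙ b ≤ᵥ f ⊗ g
≤ᵥ-⊗ {a} {b} {f} {g} a≤f b≤g n n<a+b = sumℤ-zero (suc n) vanish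
  where
  vanish : ∀ i → i < suc n → f i * g (n ∸ i) ≡ + 0
  vanish i i≤n with i <? a
  ... | yes i<a = trans (cong (_* g (n ∸ i)) (a≤f i i<a)) (ℤ.*-zeroˡ (g (n ∸ i)))
  ... | no  i≮a = trans (cong (f i *_) (b≤g (n ∸ i) n∸i<b)) (ℤ.*-zeroʳ (f i))
    where
    a≤i : a ≤ i
    a≤i = ℕ.≮⇒≥ i≮a
    a≤n : a ≤ n
    a≤n = ℕ.≤-trans a≤i (ℕ.≤-pred i≤n)
    n∸i<b : n ∸ i < b
    n∸i<b = ℕ.≤-<-trans (ℕ.∸-monoʳ-≤ n a≤i)
      (ℕ.+-cancelˡ-< a (n ∸ a) b (subst (_< a +ₙ b) (sym (ℕ.m+[n∸m]≡n a≤n)) n<a+b))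

opaque
  unfolding _⊕′_ _⊗′_ ⊝′_

  ≤ᵥ-⊕′ : ∀ {a f g} → a ≤ᵥ f → a ≤ᵥ g → a ≤ᵥ f ⊕′ g
  ≤ᵥ-⊕′ a≤f a≤g n n<a = cong₂ _+_ (a≤f n n<a) (a≤g n n<a)

  ≤ᵥ-⊝′ : ∀ {a f} → a ≤ᵥ f → a ≤ᵥ ⊝′ f
  ≤ᵥ-⊝′ a≤f n n<a = cong -_ (a≤f n n<a)

  ≤ᵥ-⊗′ : ∀ {a b f g} → a ≤ᵥ f → b ≤ᵥ g → a +ₙ b ≤ᵥ f ⊗′ g
  ≤ᵥ-⊗′ = ≤ᵥ-⊗

≤ᵥ-⊗′ˡ : ∀ {a} f {g} → a ≤ᵥ g → a ≤ᵥ f ⊗′ g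
≤ᵥ-⊗′ˡ f = ≤ᵥ-⊗′ {0} (λ _ ())

≤ᵥ-⊗′ʳ : ∀ {a f} g → a ≤ᵥ f → a ≤ᵥ f ⊗′ g
≤ᵥ-⊗′ʳ {a} g a≤f = ≤ᵥ-mono (ℕ.m≤m+n a 0) (≤ᵥ-⊗′ {a} {0} a≤f (λ _ ()))

Σ∞-cong : ∀ {F G} → (∀ j → F j ≈ G j) → Σ∞ F ≈ Σ∞ G
Σ∞-cong F≈G N = sumℤ-cong (suc N) (λ j → F≈G j N)

Σ∞-⊕ : ∀ F G → Σ∞ (λ j → F j ⊕ G j) ≈ Σ∞ F ⊕ Σ∞ G
Σ∞-⊕ F G N = sumℤ-+ (suc N) (λ j → F j N) (λ j → G j N)

Σ∞-· : ∀ c F → Σ∞ (λ j → c · F j) ≈ c · Σ∞ F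
Σ∞-· c F N = sumℤ-*ˡ (suc N) c (λ j → F j N)

opaque
  unfolding _⊕′_ _⊗′_ ⊝′_

  Σ∞-⊕′ : ∀ F G → Σ∞ (λ j → F j ⊕′ G j) ≈ Σ∞ F ⊕′ Σ∞ G
  Σ∞-⊕′ F G N = sumℤ-+ (suc N) (λ j → F j N) (λ j → G j N)

  Σ∞-head : ∀ F → Summable F → Σ∞ F ≈ F 0 ⊕′ Σ∞ (F ∘ suc)
  Σ∞-head F F-summable N = trans (sumℤ-head N (λ j → F j N))
    (cong (λ x → F 0 N + x)
      (sym (trans (cong (λ x → sumℤ N (λ j → F (suc j) N) + x) (F-summable (suc N) N (ℕ.n<1+n N)))
                  (ℤ.+-identityʳ _))))

  Σ∞-telescope : ∀ G → Summable G → Σ∞ (λ j → G j ⊖′ G (suc j)) ≈ G 0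
  Σ∞-telescope G G-summable N = trans (sumℤ-telescope (suc N) (λ j → G j N))
    (trans (cong (λ x → G 0 N - x) (G-summable (suc N) N (ℕ.n<1+n N))) (ℤ.+-identityʳ (G 0 N)))

  Σ∞-⊗′ˡ : ∀ g F → Summable F → g ⊗′ Σ∞ F ≈ Σ∞ (λ j → g ⊗′ F j)
  Σ∞-⊗′ˡ g F F-summable N = begin
      sumℤ (suc N) (λ i → g i * sumℤ (suc (N ∸ i)) (λ j → F j (N ∸ i)))
    ≡⟨ sumℤ-cong (suc N) (λ i → cong (g i *_) (sym (sumℤ-pad _ (s≤s (ℕ.m∸n≤m N i))
          (λ j N∸i<j → F-summable j (N ∸ i) N∸i<j)))) ⟩
      sumℤ (suc N) (λ i → g i * sumℤ (suc N) (λ j → F j (N ∸ i)))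
    ≡⟨ sumℤ-cong (suc N) (λ i → sym (sumℤ-*ˡ (suc N) (g i) _)) ⟩
      sumℤ (suc N) (λ i → sumℤ (suc N) (λ j → g i * F j (N ∸ i)))
    ≡⟨ sumℤ-comm (suc N) (suc N) _ ⟩
      sumℤ (suc N) (λ j → (g ⊗ F j) N)
    ∎
    where open ≡-Reasoning

  Σ∞-pairs : ∀ F → Summable F → F 0 ≈ 0ₛ → Σ∞ F ≈ Σ∞ (λ j → F (suc (2 *ₙ j)) ⊕′ F (suc (suc (2 *ₙ j))))
  Σ∞-pairs F F-summable F0≈0 N = sym (begin
      sumℤ (suc N) (λ j → pair j)
    ≡⟨ sym (ℤ.+-identityˡ _) ⟩
      + 0 + sumℤ (suc N) (λ j → pair j)
    ≡⟨ cong (_+ sumℤ (suc N) (λ j → pair j)) (sym (trans (F0≈0 N) (cst-0 N))) ⟩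
      F 0 N + sumℤ (suc N) (λ j → pair j)
    ≡⟨ pairs (suc N) ⟩
      sumℤ (suc (2 *ₙ suc N)) (λ j → F j N)
    ≡⟨ sumℤ-pad _ (ℕ.m≤n⇒m≤1+n (ℕ.m≤m+n (suc N) _)) (λ j N<j → F-summable j N N<j) ⟩
      sumℤ (suc N) (λ j → F j N)
    ∎)
    where
    open ≡-Reasoning
    pair : ℕ → ℤ
    pair j = F (suc (2 *ₙ j)) N + F (suc (suc (2 *ₙ j))) N
    pairs : ∀ M → F 0 N + sumℤ M pair ≡ sumℤ (suc (2 *ₙ M)) (λ j → F j N)
    pairs zero    = trans (ℤ.+-identityʳ (F 0 N)) (sym (ℤ.+-identityˡ (F 0 N)))
    pairs (suc M) = begin
        F 0 N + (sumℤ M pair + pair M)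
      ≡⟨ sym (ℤ.+-assoc (F 0 N) (sumℤ M pair) (pair M)) ⟩
        (F 0 N + sumℤ M pair) + pair M
      ≡⟨ cong (_+ pair M) (pairs M) ⟩
        sumℤ (suc (2 *ₙ M)) (λ j → F j N) + pair M
      ≡⟨ sym (ℤ.+-assoc (sumℤ (suc (2 *ₙ M)) (λ j → F j N)) _ _) ⟩
        sumℤ (suc (suc (suc (2 *ₙ M)))) (λ j → F j N)
      ≡⟨ cong (λ t → sumℤ (suc t) (λ j → F j N)) (sym (ℕ.*-suc 2 M)) ⟩
        sumℤ (suc (2 *ₙ suc M)) (λ j → F j N)
      ∎

Σ∞-shift-telescope : ∀ F A G → Summable F → Summable G →
  (∀ n → F (suc n) ≈ A n ⊕′ (G n ⊖′ G (suc n))) → Σ∞ F ≈ (F 0 ⊕′ G 0) ⊕′ Σ∞ A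
Σ∞-shift-telescope F A G F-summable G-summable step = begin
  Σ∞ F
    ≈⟨ Σ∞-head F F-summable ⟩
  F 0 ⊕′ Σ∞ (F ∘ suc)
    ≈⟨ ⊕′-cong (≈-refl {F 0}) (Σ∞-cong step) ⟩
  F 0 ⊕′ Σ∞ (λ n → A n ⊕′ (G n ⊖′ G (suc n)))
    ≈⟨ ⊕′-cong (≈-refl {F 0}) (Σ∞-⊕′ A _) ⟩
  F 0 ⊕′ (Σ∞ A ⊕′ Σ∞ (λ n → G n ⊖′ G (suc n)))
    ≈⟨ ⊕′-cong (≈-refl {F 0}) (⊕′-cong (≈-refl {Σ∞ A}) (Σ∞-telescope G G-summable)) ⟩
  F 0 ⊕′ (Σ∞ A ⊕′ G 0)
    ≈⟨ solve 3 (λ f a g → f :+ (a :+ g) := (f :+ g) :+ a) ≈-refl (F 0) (Σ∞ A) (G 0) ⟩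
  (F 0 ⊕′ G 0) ⊕′ Σ∞ A
    ∎
  where open ≈-Reasoning

opaque
  unfolding _⊕′_

  Σfin-suc : ∀ n F → Σfin (suc n) F ≈ Σfin n F ⊕′ F n
  Σfin-suc n F = ≈-refl

  Σfin-head : ∀ n F → Σfin (suc n) F ≈ F 0 ⊕′ Σfin n (F ∘ suc)
  Σfin-head n F m = sumℤ-head n (λ t → F t m)

Σfin-cong : ∀ n {F G} → (∀ t → F t ≈ G t) → Σfin n F ≈ Σfin n G
Σfin-cong n F≈G m = sumℤ-cong n (λ t → F≈G t m)

Σfin-⊗′ˡ : ∀ n g F → g ⊗′ Σfin n F ≈ Σfin n (λ t → g ⊗′ F t)
Σfin-⊗′ˡ zero    g F = begin
  g ⊗′ Σfin 0 F  ≈⟨ ⊗′-cong (≈-refl {g}) (≈-sym cst-0) ⟩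
  g ⊗′ 0ₛ        ≈⟨ solve 1 (λ g → g :* con (+ 0) := con (+ 0)) ≈-refl g ⟩
  0ₛ             ≈⟨ cst-0 ⟩
  Σfin 0 (λ t → g ⊗′ F t) ∎
  where open ≈-Reasoning
Σfin-⊗′ˡ (suc n) g F = begin
  g ⊗′ Σfin (suc n) F              ≈⟨ ⊗′-cong (≈-refl {g}) (Σfin-suc n F) ⟩
  g ⊗′ (Σfin n F ⊕′ F n)           ≈⟨ solve 3 (λ g a b → g :* (a :+ b) := g :* a :+ g :* b) ≈-refl g (Σfin n F) (F n) ⟩
  g ⊗′ Σfin n F ⊕′ g ⊗′ F n        ≈⟨ ⊕′-cong (Σfin-⊗′ˡ n g F) (≈-refl {g ⊗′ F n}) ⟩
  Σfin n (λ t → g ⊗′ F t) ⊕′ g ⊗′ F n ≈⟨ ≈-sym (Σfin-suc n (λ t → g ⊗′ F t)) ⟩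
  Σfin (suc n) (λ t → g ⊗′ F t)    ∎
  where open ≈-Reasoning

-- Reciprocals and the q-Pochhammer symbol (-q^{2k+2}; q^2)_n

⊗-at-0 : ∀ f g → (f ⊗ g) 0 ≡ f 0 * g 0
⊗-at-0 f g = ℤ.+-identityˡ (f 0 * g 0)

1⊕-at-0 : ∀ g → 1 ≤ᵥ g → (1ₛ ⊕ g) 0 ≡ + 1
1⊕-at-0 g 1≤g = cong (λ x → + 1 + x) (1≤g 0 (s≤s z≤n))

1⊖-at-0 : ∀ g → 1 ≤ᵥ g → (1ₛ ⊖ g) 0 ≡ + 1
1⊖-at-0 g 1≤g = cong (λ x → + 1 + - x) (1≤g 0 (s≤s z≤n))

^ₛ-cong : ∀ {f g} t → f ≈ g → f ^ₛ t ≈ g ^ₛ t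
^ₛ-cong zero    f≈g = ≈-refl
^ₛ-cong (suc t) f≈g = ⊗-cong f≈g (^ₛ-cong t f≈g)

inv-cong : ∀ {f g} → f ≈ g → inv f ≈ inv g
inv-cong f≈g = Σ∞-cong (λ t → ^ₛ-cong t (⊕-cong (≈-refl {1ₛ}) (⊝-cong f≈g)))

-- inv f is the geometric series in h = 1 - f, so h * inv f = inv f - 1.
inv-inverseʳ : ∀ f → f 0 ≡ + 1 → f ⊗′ inv f ≈ 1ₛ
inv-inverseʳ f f0≡1 = begin
  f ⊗′ inv f                        ≈⟨ solve 2 (λ f I → f :* I := I :- (con (+ 1) :- f) :* I) ≈-refl f (inv f) ⟩
  inv f ⊖′ (1ₛ ⊖′ f) ⊗′ inv f       ≈⟨ ⊖′-cong (Σ∞-head H H-summable) (⊗′-cong (⊖′≈⊖ 1ₛ f) ≈-refl) ⟩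
  (1ₛ ⊕′ X) ⊖′ h ⊗′ inv f           ≈⟨ ⊖′-cong (≈-refl {1ₛ ⊕′ X}) (Σ∞-⊗′ˡ h H H-summable) ⟩
  (1ₛ ⊕′ X) ⊖′ Σ∞ (λ t → h ⊗′ H t)  ≈⟨ ⊖′-cong (≈-refl {1ₛ ⊕′ X}) (Σ∞-cong (λ t → ⊗′≈⊗ h (H t))) ⟩
  (1ₛ ⊕′ X) ⊖′ X                    ≈⟨ solve 1 (λ X → (con (+ 1) :+ X) :- X := con (+ 1)) ≈-refl X ⟩
  1ₛ                                ∎
  where
  open ≈-Reasoning
  h : PS
  h = 1ₛ ⊖ f
  H : ℕ → PS
  H t = h ^ₛ t
  X : PS
  X = Σ∞ (H ∘ suc)
  1≤h : 1 ≤ᵥ h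
  1≤h zero    _              = cong (λ x → + 1 + - x) f0≡1
  1≤h (suc n) (s≤s ())
  H-summable : Summable H
  H-summable zero    = λ _ ()
  H-summable (suc t) = ≤ᵥ-⊗ {1} {t} 1≤h (H-summable t)

inv-unique : ∀ {f g h} → f 0 ≡ + 1 → g ⊗′ f ≈ h → g ≈ h ⊗′ inv f
inv-unique {f} {g} {h} f0≡1 g⊗f≈h = begin
  g                    ≈⟨ solve 1 (λ g → g := g :* con (+ 1)) ≈-refl g ⟩
  g ⊗′ 1ₛ              ≈⟨ ⊗′-cong (≈-refl {g}) (≈-sym (inv-inverseʳ f f0≡1)) ⟩
  g ⊗′ (f ⊗′ inv f)    ≈⟨ solve 3 (λ g f I → g :* (f :* I) := g :* f :* I) ≈-refl g f (inv f) ⟩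
  g ⊗′ f ⊗′ inv f      ≈⟨ ⊗′-cong g⊗f≈h (≈-refl {inv f}) ⟩
  h ⊗′ inv f           ∎
  where open ≈-Reasoning

inv-1 : inv 1ₛ ≈ 1ₛ
inv-1 = ≈-sym (≈-trans (inv-unique {1ₛ} {1ₛ} refl (solve 0 (con (+ 1) :* con (+ 1) := con (+ 1)) ≈-refl))
                       (solve 1 (λ I → con (+ 1) :* I := I) ≈-refl (inv 1ₛ)))

inv-⊗ : ∀ f g → f 0 ≡ + 1 → g 0 ≡ + 1 → inv f ≈ g ⊗′ inv (f ⊗ g)
inv-⊗ f g f0≡1 g0≡1 =
  ≈-sym (≈-trans (inv-unique f0≡1 cancel) (solve 1 (λ I → con (+ 1) :* I := I) ≈-refl (inv f)))
  where
  open ≈-Reasoning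
  fg0≡1 : (f ⊗ g) 0 ≡ + 1
  fg0≡1 = trans (⊗-at-0 f g) (cong₂ _*_ f0≡1 g0≡1)
  cancel : g ⊗′ inv (f ⊗ g) ⊗′ f ≈ 1ₛ
  cancel = begin
    g ⊗′ inv (f ⊗ g) ⊗′ f    ≈⟨ solve 3 (λ g I f → g :* I :* f := (f :* g) :* I) ≈-refl g (inv (f ⊗ g)) f ⟩
    f ⊗′ g ⊗′ inv (f ⊗ g)    ≈⟨ ⊗′-cong (⊗′≈⊗ f g) ≈-refl ⟩
    (f ⊗ g) ⊗′ inv (f ⊗ g)   ≈⟨ inv-inverseʳ (f ⊗ g) fg0≡1 ⟩
    1ₛ                       ∎

Πfin-cong : ∀ n {F G} → (∀ j → F j ≈ G j) → Πfin n F ≈ Πfin n G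
Πfin-cong zero    F≈G = ≈-refl
Πfin-cong (suc n) F≈G = ⊗-cong (Πfin-cong n F≈G) (F≈G n)

Πfin-head : ∀ n F → Πfin (suc n) F ≈ F 0 ⊗ Πfin n (F ∘ suc)
Πfin-head zero    F = ≈-trans (⊗-identityˡ (F 0)) (≈-trans (≈-sym (⊗-identityˡ (F 0))) (⊗-comm 1ₛ (F 0)))
Πfin-head (suc n) F = ≈-trans (⊗-cong (Πfin-head n F) (≈-refl {F (suc n)}))
                             (⊗-assoc (F 0) (Πfin n (F ∘ suc)) (F (suc n)))

Πfin-at-0 : ∀ n F → (∀ j → F j 0 ≡ + 1) → Πfin n F 0 ≡ + 1
Πfin-at-0 zero    F F0≡1 = refl
Πfin-at-0 (suc n) F F0≡1 = trans (⊗-at-0 (Πfin n F) (F n)) (cong₂ _*_ (Πfin-at-0 n F F0≡1) (F0≡1 n))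

-- Indexed so that (-q^{2k+2}; q^2)_n is the product of pochFactor k m for 1 ≤ m ≤ n.
pochFactor : ℕ → ℕ → PS
pochFactor k m = 1ₛ ⊕′ q^ (2 *ₙ k +ₙ 2 *ₙ m)

pochFactor-1 : ∀ k → pochFactor k 1 ≈ 1ₛ ⊕′ q^ (2 *ₙ k) ⊗′ q^ 2
pochFactor-1 k = ⊕′-cong (≈-refl {1ₛ}) (q^-∑ (2 *ₙ k) (2 ∷ []) refl)

private
  factor : ℕ → ℕ → PS
  factor k j = 1ₛ ⊖ ⊝ q^ (2 *ₙ k +ₙ 2) ⊗ (q^ 2 ^ₛ j)

  factor≈pochFactor : ∀ k j → factor k j ≈ pochFactor k (suc j)
  factor≈pochFactor k j = begin
    1ₛ ⊖ ⊝ q^ (2 *ₙ k +ₙ 2) ⊗ (q^ 2 ^ₛ j)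
      ≈⟨ ⊖-cong′ ≈-refl (⊗-cong′ (≈-sym (⊝′≈⊝ _)) (q^-^ₛ 2 j)) ⟩
    1ₛ ⊖′ ⊝′ q^ (2 *ₙ k +ₙ 2) ⊗′ q^ (2 *ₙ j)
      ≈⟨ solve 2 (λ x y → con (+ 1) :- (:- x) :* y := con (+ 1) :+ x :* y) ≈-refl _ _ ⟩
    1ₛ ⊕′ q^ (2 *ₙ k +ₙ 2) ⊗′ q^ (2 *ₙ j)
      ≈⟨ ⊕′-cong ≈-refl (≈-trans (≈-sym (q^-+′ _ _)) (q^-cong (exponent k j))) ⟩
    1ₛ ⊕′ q^ (2 *ₙ k +ₙ 2 *ₙ suc j)
      ∎
    where
    open ≈-Reasoning
    exponent : ∀ k j → 2 *ₙ k +ₙ 2 +ₙ 2 *ₙ j ≡ 2 *ₙ k +ₙ 2 *ₙ suc j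
    exponent = solve-∀

  factor-at-0 : ∀ k j → factor k j 0 ≡ + 1
  factor-at-0 k j = 1⊖-at-0 _ (≤ᵥ-mono (ℕ.m≤m+n 1 0) (≤ᵥ-⊗ {1} {0} {⊝ q^ (2 *ₙ k +ₙ 2)} {q^ 2 ^ₛ j} 1≤-q^ (λ _ ())))
    where
    1≤-q^ : 1 ≤ᵥ ⊝ q^ (2 *ₙ k +ₙ 2)
    1≤-q^ n n<1 = cong -_ (≤ᵥ-q^-+ (2 *ₙ k +ₙ 2) (2 *ₙ k +ₙ 1) (ℕ.+-suc (2 *ₙ k) 1) n n<1)

  poch-at-0 : ∀ k n → poch (⊝ q^ (2 *ₙ k +ₙ 2)) (q^ 2) n 0 ≡ + 1
  poch-at-0 k n = Πfin-at-0 n (factor k) (factor-at-0 k)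

invPoch-suc : ∀ k n → invPoch k n ≈ pochFactor k (suc n) ⊗′ invPoch k (suc n)
invPoch-suc k n = ≈-trans (inv-⊗ _ (factor k n) (poch-at-0 k n) (factor-at-0 k n))
                          (⊗′-cong (factor≈pochFactor k n) ≈-refl)

invPoch-sucᵏ : ∀ k n → invPoch (suc k) n ≈ pochFactor k 1 ⊗′ invPoch k (suc n)
invPoch-sucᵏ k n = ≈-trans (inv-⊗ _ (factor k 0) (poch-at-0 (suc k) n) (factor-at-0 k 0))
  (⊗′-cong (factor≈pochFactor k 0) (inv-cong (≈-trans (⊗-comm (Πfin n (factor (suc k))) (factor k 0))
    (≈-sym (≈-trans (Πfin-head n (factor k)) (⊗-cong (≈-refl {factor k 0}) (Πfin-cong n shift)))))))
  where
  shift : ∀ j → factor k (suc j) ≈ factor (suc k) j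
  shift j = ≈-trans (factor≈pochFactor k (suc j))
    (≈-trans (⊕′-cong ≈-refl (q^-cong (exponent k j))) (≈-sym (factor≈pochFactor (suc k) j)))
    where
    exponent : ∀ k j → 2 *ₙ k +ₙ 2 *ₙ suc (suc j) ≡ 2 *ₙ suc k +ₙ 2 *ₙ suc j
    exponent = solve-∀

-- q-adic descent

-- Each coefficient of D k is a finite combination of strictly lower
-- coefficients of D (suc k), so induction on the coefficient index works.
descent : ∀ (D g : ℕ → PS) → (∀ k → 1 ≤ᵥ g k) → (∀ k → D k ≈ g k ⊗′ D (suc k)) → ∀ k → D k ≈ 0ₛ
descent D g 1≤g D-rec k m = trans (vanish m k m ℕ.≤-refl) (sym (cst-0 m))
  where
  lower : ∀ k m → D k m ≡ sumℤ m (λ i → g k (suc i) * D (suc k) (m ∸ suc i))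
  lower k m = begin
    D k m                                                            ≡⟨ D-rec k m ⟩
    (g k ⊗′ D (suc k)) m                                             ≡⟨ ⊗′≈⊗ (g k) (D (suc k)) m ⟩
    (g k ⊗ D (suc k)) m                                              ≡⟨ sumℤ-head m (λ i → g k i * D (suc k) (m ∸ i)) ⟩
    g k 0 * D (suc k) m + sumℤ m (λ i → g k (suc i) * D (suc k) (m ∸ suc i))
      ≡⟨ cong (λ x → x * D (suc k) m + sumℤ m (λ i → g k (suc i) * D (suc k) (m ∸ suc i))) (1≤g k 0 (s≤s z≤n)) ⟩
    + 0 * D (suc k) m + sumℤ m (λ i → g k (suc i) * D (suc k) (m ∸ suc i))
      ≡⟨ ℤ.+-identityˡ _ ⟩
    sumℤ m (λ i → g k (suc i) * D (suc k) (m ∸ suc i))               ∎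
    where open ≡-Reasoning
  vanish : ∀ N k m → m ≤ N → D k m ≡ + 0
  vanish zero    k .zero z≤n = lower k 0
  vanish (suc N) k m    m≤N = trans (lower k m) (sumℤ-zero m (λ i i<m →
    trans (cong (g k (suc i) *_) (vanish N (suc k) (m ∸ suc i) (ℕ.≤-trans (ℕ.∸-monoʳ-≤ m (s≤s z≤n)) (ℕ.∸-monoˡ-≤ 1 m≤N))))
          (ℤ.*-zeroʳ (g k (suc i)))))

-- The series C and T as functions of k

z : ℕ → PS
z k = q^ (2 *ₙ k)

z-suc : ∀ k → z (suc k) ≈ z k ⊗′ q^ 2
z-suc k = q^-∑ (2 *ₙ k) (2 ∷ []) (trans (ℕ.*-suc 2 k) (ℕ.+-comm 2 (2 *ₙ k)))

yₑ hₑ : ℕ → ℕ → ℕ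
yₑ k n = 3 *ₙ n *ₙ n +ₙ (6 *ₙ k +ₙ 1) *ₙ n +ₙ 2 *ₙ k
hₑ k n = 4 *ₙ n +ₙ 4 *ₙ k +ₙ 2

t c : ℕ → ℕ → PS
t k n = z k ⊗′ (q^ (yₑ k n) ⊗′ (q^ (hₑ k n) ⊖′ 1ₛ))
c k n = ι (6 *ₙ n +ₙ 4) · (q^ (yₑ k n) ⊗′ (q^ (hₑ k n) ⊖′ 1ₛ)) ⊕′ ι 4 · (q^ (yₑ k n) ⊗′ q^ (hₑ k n))

T : ℕ → PS
T k = Σ∞ (t k)

n≤ᵥq^yₑ : ∀ k n → n ≤ᵥ q^ (yₑ k n)
n≤ᵥq^yₑ k n = ≤ᵥ-q^-+ (yₑ k n) _ (exponent k n)
  where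
  exponent : ∀ k n → 3 *ₙ n *ₙ n +ₙ (6 *ₙ k +ₙ 1) *ₙ n +ₙ 2 *ₙ k ≡ n +ₙ (3 *ₙ n *ₙ n +ₙ 6 *ₙ k *ₙ n +ₙ 2 *ₙ k)
  exponent = solve-∀

t-summable : ∀ k → Summable (t k)
t-summable k n = ≤ᵥ-⊗′ˡ (z k) (≤ᵥ-⊗′ʳ (q^ (hₑ k n) ⊖′ 1ₛ) (n≤ᵥq^yₑ k n))

c-summable : ∀ k → Summable (c k)
c-summable k n = ≤ᵥ-⊕′ (≤ᵥ-· (ι (6 *ₙ n +ₙ 4)) _ (≤ᵥ-⊗′ʳ (q^ (hₑ k n) ⊖′ 1ₛ) (n≤ᵥq^yₑ k n)))
                       (≤ᵥ-· (ι 4) _ (≤ᵥ-⊗′ʳ (q^ (hₑ k n)) (n≤ᵥq^yₑ k n)))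

C≈Σc : ∀ k → C k ≈ Σ∞ (c k)
C≈Σc k = ≈-sym (begin
  Σ∞ (c k)                                   ≈⟨ Σ∞-⊕′ _ _ ⟩
  Σ∞ (λ n → ι (6 *ₙ n +ₙ 4) · t′ n) ⊕′ Σ∞ (λ n → ι 4 · m′ n)
                                             ≈⟨ ⊕′≈⊕ _ _ ⟩
  Σ∞ (λ n → ι (6 *ₙ n +ₙ 4) · t′ n) ⊕ Σ∞ (λ n → ι 4 · m′ n)
                                             ≈⟨ ⊕-cong (Σ∞-cong (λ n → ·-cong (ι (6 *ₙ n +ₙ 4)) (t′≈ n))) (Σ∞-· (ι 4) m′) ⟩
  Σ∞ (λ n → ι (6 *ₙ n +ₙ 4) · (q^ (yₑ k n) ⊗ (q^ (hₑ k n) ⊖ 1ₛ))) ⊕ ι 4 · Σ∞ m′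
                                             ≈⟨ ⊕-cong (≈-refl {Σ∞ (λ n → ι (6 *ₙ n +ₙ 4) · (q^ (yₑ k n) ⊗ (q^ (hₑ k n) ⊖ 1ₛ)))})
                                                       (·-cong (ι 4) (Σ∞-cong m′≈)) ⟩
  C k                                        ∎)
  where
  open ≈-Reasoning
  t′ m′ : ℕ → PS
  t′ n = q^ (yₑ k n) ⊗′ (q^ (hₑ k n) ⊖′ 1ₛ)
  m′ n = q^ (yₑ k n) ⊗′ q^ (hₑ k n)
  t′≈ : ∀ n → t′ n ≈ q^ (yₑ k n) ⊗ (q^ (hₑ k n) ⊖ 1ₛ)
  t′≈ n = ≈-trans (⊗′≈⊗ _ _) (⊗-cong (≈-refl {q^ (yₑ k n)}) (⊖′≈⊖ _ _))
  exponent : ∀ k n → 3 *ₙ n *ₙ n +ₙ (6 *ₙ k +ₙ 1) *ₙ n +ₙ 4 *ₙ n +ₙ 6 *ₙ k +ₙ 2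
                   ≡ (3 *ₙ n *ₙ n +ₙ (6 *ₙ k +ₙ 1) *ₙ n +ₙ 2 *ₙ k) +ₙ (4 *ₙ n +ₙ 4 *ₙ k +ₙ 2)
  exponent = solve-∀
  m′≈ : ∀ n → m′ n ≈ q^ (3 *ₙ n *ₙ n +ₙ (6 *ₙ k +ₙ 1) *ₙ n +ₙ 4 *ₙ n +ₙ 6 *ₙ k +ₙ 2)
  m′≈ n = ≈-trans (≈-sym (q^-+′ _ _)) (q^-cong (sym (exponent k n)))

-- Each summand identity is proved by writing all monomials as products of a
-- few atoms with q^-∑ and comparing the resulting polynomials in the atoms
-- with the ring solver.
module _ (k n : ℕ) where
  private
    Y Z W Q P : PS
    Y = q^ (yₑ k n)
    Z = z k
    W = q^ (2 *ₙ n)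
    Q = q^ 2
    P = q^ (hₑ (suc k) n)

    Y-sucₙ : q^ (yₑ k (suc n)) ≈ Y ⊗′ W ⊗′ W ⊗′ W ⊗′ Q ⊗′ Q ⊗′ Z ⊗′ Z ⊗′ Z
    Y-sucₙ = q^-∑ (yₑ k n) (2 *ₙ n ∷ 2 *ₙ n ∷ 2 *ₙ n ∷ 2 ∷ 2 ∷ 2 *ₙ k ∷ 2 *ₙ k ∷ 2 *ₙ k ∷ []) (exponent k n)
      where
      exponent : ∀ k n → 3 *ₙ suc n *ₙ suc n +ₙ (6 *ₙ k +ₙ 1) *ₙ suc n +ₙ 2 *ₙ k
                       ≡ 3 *ₙ n *ₙ n +ₙ (6 *ₙ k +ₙ 1) *ₙ n +ₙ 2 *ₙ k +ₙ 2 *ₙ n +ₙ 2 *ₙ n +ₙ 2 *ₙ n +ₙ 2 +ₙ 2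
                         +ₙ 2 *ₙ k +ₙ 2 *ₙ k +ₙ 2 *ₙ k
      exponent = solve-∀

    Y-sucₖ : q^ (yₑ (suc k) n) ≈ Y ⊗′ W ⊗′ W ⊗′ W ⊗′ Q
    Y-sucₖ = q^-∑ (yₑ k n) (2 *ₙ n ∷ 2 *ₙ n ∷ 2 *ₙ n ∷ 2 ∷ []) (exponent k n)
      where
      exponent : ∀ k n → 3 *ₙ n *ₙ n +ₙ (6 *ₙ suc k +ₙ 1) *ₙ n +ₙ 2 *ₙ suc k
                       ≡ 3 *ₙ n *ₙ n +ₙ (6 *ₙ k +ₙ 1) *ₙ n +ₙ 2 *ₙ k +ₙ 2 *ₙ n +ₙ 2 *ₙ n +ₙ 2 *ₙ n +ₙ 2
      exponent = solve-∀

    H-sucₙ : q^ (hₑ k (suc n)) ≈ P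
    H-sucₙ = q^-cong (exponent k n)
      where
      exponent : ∀ k n → 4 *ₙ suc n +ₙ 4 *ₙ k +ₙ 2 ≡ 4 *ₙ n +ₙ 4 *ₙ suc k +ₙ 2
      exponent = solve-∀


  t-sucₙ : t k (suc n) ≈ Z ⊗′ Z ⊗′ Z ⊗′ t (suc k) n
  t-sucₙ = begin
    t k (suc n)
      ≈⟨ ⊗′-cong (≈-refl {Z}) (⊗′-cong Y-sucₙ (⊖′-cong H-sucₙ (≈-refl {1ₛ}))) ⟩
    Z ⊗′ ((Y ⊗′ W ⊗′ W ⊗′ W ⊗′ Q ⊗′ Q ⊗′ Z ⊗′ Z ⊗′ Z) ⊗′ (P ⊖′ 1ₛ))
      ≈⟨ solve 5 (λ Y Z W Q P →
           Z :* ((Y :* W :* W :* W :* Q :* Q :* Z :* Z :* Z) :* (P :- con (+ 1)))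
           := Z :* Z :* Z :* ((Z :* Q) :* ((Y :* W :* W :* W :* Q) :* (P :- con (+ 1))))) ≈-refl Y Z W Q P ⟩
    Z ⊗′ Z ⊗′ Z ⊗′ ((Z ⊗′ Q) ⊗′ ((Y ⊗′ W ⊗′ W ⊗′ W ⊗′ Q) ⊗′ (P ⊖′ 1ₛ)))
      ≈⟨ ⊗′-cong (≈-refl {Z ⊗′ Z ⊗′ Z}) (≈-sym (⊗′-cong (z-suc k) (⊗′-cong Y-sucₖ (≈-refl {P ⊖′ 1ₛ})))) ⟩
    Z ⊗′ Z ⊗′ Z ⊗′ t (suc k) n
      ∎
    where open ≈-Reasoning

  private
    N : PS
    N = cst (ι (6 *ₙ n +ₙ 4))

    N-suc : cst (ι (6 *ₙ suc n +ₙ 4)) ≈ N ⊕′ cst (+ 6)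
    N-suc = ≈-trans (cst-cong (trans (cong ι (exponent n)) (ℤ.pos-+ (6 *ₙ n +ₙ 4) 6)))
                    (cst-homo-+ (ι (6 *ₙ n +ₙ 4)) (+ 6))
      where
      exponent : ∀ n → 6 *ₙ suc n +ₙ 4 ≡ 6 *ₙ n +ₙ 4 +ₙ 6
      exponent = solve-∀

  c-sucₙ : c k (suc n) ≈ cst (+ 6) ⊗′ (Z ⊗′ Z) ⊗′ t (suc k) n ⊕′ Z ⊗′ Z ⊗′ Z ⊗′ Q ⊗′ c (suc k) n
  c-sucₙ = begin
    c k (suc n)
      ≈⟨ ⊕′-cong (≈-trans (·≈cst⊗′ _ _) (⊗′-cong N-suc (⊗′-cong Y-sucₙ (⊖′-cong H-sucₙ (≈-refl {1ₛ})))))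
                 (≈-trans (·≈cst⊗′ _ _) (⊗′-cong (≈-refl {cst (+ 4)}) (⊗′-cong Y-sucₙ H-sucₙ))) ⟩
    (N ⊕′ cst (+ 6)) ⊗′ ((Y ⊗′ W ⊗′ W ⊗′ W ⊗′ Q ⊗′ Q ⊗′ Z ⊗′ Z ⊗′ Z) ⊗′ (P ⊖′ 1ₛ))
      ⊕′ cst (+ 4) ⊗′ ((Y ⊗′ W ⊗′ W ⊗′ W ⊗′ Q ⊗′ Q ⊗′ Z ⊗′ Z ⊗′ Z) ⊗′ P)
      ≈⟨ solve 6 (λ N Y Z W Q P →
           (N :+ con (+ 6)) :* ((Y :* W :* W :* W :* Q :* Q :* Z :* Z :* Z) :* (P :- con (+ 1)))
             :+ con (+ 4) :* ((Y :* W :* W :* W :* Q :* Q :* Z :* Z :* Z) :* P)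
           := con (+ 6) :* (Z :* Z) :* ((Z :* Q) :* ((Y :* W :* W :* W :* Q) :* (P :- con (+ 1))))
             :+ Z :* Z :* Z :* Q :* (N :* ((Y :* W :* W :* W :* Q) :* (P :- con (+ 1)))
                                     :+ con (+ 4) :* ((Y :* W :* W :* W :* Q) :* P))) ≈-refl N Y Z W Q P ⟩
    cst (+ 6) ⊗′ (Z ⊗′ Z) ⊗′ ((Z ⊗′ Q) ⊗′ ((Y ⊗′ W ⊗′ W ⊗′ W ⊗′ Q) ⊗′ (P ⊖′ 1ₛ)))
      ⊕′ Z ⊗′ Z ⊗′ Z ⊗′ Q ⊗′ (N ⊗′ ((Y ⊗′ W ⊗′ W ⊗′ W ⊗′ Q) ⊗′ (P ⊖′ 1ₛ))
                              ⊕′ cst (+ 4) ⊗′ ((Y ⊗′ W ⊗′ W ⊗′ W ⊗′ Q) ⊗′ P))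
      ≈⟨ ≈-sym (⊕′-cong (⊗′-cong (≈-refl {cst (+ 6) ⊗′ (Z ⊗′ Z)}) (⊗′-cong (z-suc k) (⊗′-cong Y-sucₖ (≈-refl {P ⊖′ 1ₛ}))))
                        (⊗′-cong (≈-refl {Z ⊗′ Z ⊗′ Z ⊗′ Q})
                          (⊕′-cong (≈-trans (·≈cst⊗′ _ _) (⊗′-cong (≈-refl {N}) (⊗′-cong Y-sucₖ (≈-refl {P ⊖′ 1ₛ}))))
                                   (≈-trans (·≈cst⊗′ _ _) (⊗′-cong (≈-refl {cst (+ 4)}) (⊗′-cong Y-sucₖ (≈-refl {P}))))))) ⟩
    cst (+ 6) ⊗′ (Z ⊗′ Z) ⊗′ t (suc k) n ⊕′ Z ⊗′ Z ⊗′ Z ⊗′ Q ⊗′ c (suc k) n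
      ∎
    where open ≈-Reasoning

module _ (k : ℕ) where
  private
    Z Q : PS
    Z = z k
    Q = q^ 2

    Y-zero : q^ (yₑ k 0) ≈ Z
    Y-zero = q^-cong (exponent k)
      where
      exponent : ∀ k → 3 *ₙ 0 *ₙ 0 +ₙ (6 *ₙ k +ₙ 1) *ₙ 0 +ₙ 2 *ₙ k ≡ 2 *ₙ k
      exponent = solve-∀

    H-zero : q^ (hₑ k 0) ≈ Z ⊗′ Z ⊗′ Q
    H-zero = q^-∑ (2 *ₙ k) (2 *ₙ k ∷ 2 ∷ []) (exponent k)
      where
      exponent : ∀ k → 4 *ₙ 0 +ₙ 4 *ₙ k +ₙ 2 ≡ 2 *ₙ k +ₙ 2 *ₙ k +ₙ 2
      exponent = solve-∀

  T-rec : T k ≈ Z ⊗′ (Z ⊗′ (Z ⊗′ Z ⊗′ Q ⊖′ 1ₛ)) ⊕′ Z ⊗′ Z ⊗′ Z ⊗′ T (suc k)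
  T-rec = begin
    T k                                         ≈⟨ Σ∞-head (t k) (t-summable k) ⟩
    t k 0 ⊕′ Σ∞ (t k ∘ suc)                     ≈⟨ ⊕′-cong (⊗′-cong (≈-refl {Z}) (⊗′-cong Y-zero (⊖′-cong H-zero (≈-refl {1ₛ}))))
                                                           (Σ∞-cong (t-sucₙ k)) ⟩
    Z ⊗′ (Z ⊗′ (Z ⊗′ Z ⊗′ Q ⊖′ 1ₛ)) ⊕′ Σ∞ (λ n → Z ⊗′ Z ⊗′ Z ⊗′ t (suc k) n)
                                                ≈⟨ ⊕′-cong (≈-refl {Z ⊗′ (Z ⊗′ (Z ⊗′ Z ⊗′ Q ⊖′ 1ₛ))})
                                                           (≈-sym (Σ∞-⊗′ˡ (Z ⊗′ Z ⊗′ Z) (t (suc k)) (t-summable (suc k)))) ⟩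
    Z ⊗′ (Z ⊗′ (Z ⊗′ Z ⊗′ Q ⊖′ 1ₛ)) ⊕′ Z ⊗′ Z ⊗′ Z ⊗′ T (suc k)
                                                ∎
    where open ≈-Reasoning

  C-rec : C k ≈ cst (+ 4) ⊗′ (Z ⊗′ (Z ⊗′ Z ⊗′ Q ⊖′ 1ₛ)) ⊕′ cst (+ 4) ⊗′ (Z ⊗′ (Z ⊗′ Z ⊗′ Q))
                ⊕′ (cst (+ 6) ⊗′ (Z ⊗′ Z) ⊗′ T (suc k) ⊕′ Z ⊗′ Z ⊗′ Z ⊗′ Q ⊗′ C (suc k))
  C-rec = begin
    C k                                         ≈⟨ C≈Σc k ⟩
    Σ∞ (c k)                                    ≈⟨ Σ∞-head (c k) (c-summable k) ⟩
    c k 0 ⊕′ Σ∞ (c k ∘ suc)                     ≈⟨ ⊕′-cong c-zero (Σ∞-cong (c-sucₙ k)) ⟩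
    cst (+ 4) ⊗′ (Z ⊗′ (Z ⊗′ Z ⊗′ Q ⊖′ 1ₛ)) ⊕′ cst (+ 4) ⊗′ (Z ⊗′ (Z ⊗′ Z ⊗′ Q))
      ⊕′ Σ∞ (λ n → cst (+ 6) ⊗′ (Z ⊗′ Z) ⊗′ t (suc k) n ⊕′ Z ⊗′ Z ⊗′ Z ⊗′ Q ⊗′ c (suc k) n)
                                                ≈⟨ ⊕′-cong ≈-refl (≈-trans (Σ∞-⊕′ _ _) (⊕′-cong
                                                     (≈-sym (Σ∞-⊗′ˡ _ (t (suc k)) (t-summable (suc k))))
                                                     (≈-sym (Σ∞-⊗′ˡ _ (c (suc k)) (c-summable (suc k)))))) ⟩
    cst (+ 4) ⊗′ (Z ⊗′ (Z ⊗′ Z ⊗′ Q ⊖′ 1ₛ)) ⊕′ cst (+ 4) ⊗′ (Z ⊗′ (Z ⊗′ Z ⊗′ Q))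
      ⊕′ (cst (+ 6) ⊗′ (Z ⊗′ Z) ⊗′ T (suc k) ⊕′ Z ⊗′ Z ⊗′ Z ⊗′ Q ⊗′ Σ∞ (c (suc k)))
                                                ≈⟨ ⊕′-cong ≈-refl (⊕′-cong ≈-refl (⊗′-cong ≈-refl (≈-sym (C≈Σc (suc k))))) ⟩
    cst (+ 4) ⊗′ (Z ⊗′ (Z ⊗′ Z ⊗′ Q ⊖′ 1ₛ)) ⊕′ cst (+ 4) ⊗′ (Z ⊗′ (Z ⊗′ Z ⊗′ Q))
      ⊕′ (cst (+ 6) ⊗′ (Z ⊗′ Z) ⊗′ T (suc k) ⊕′ Z ⊗′ Z ⊗′ Z ⊗′ Q ⊗′ C (suc k))
                                                ∎
    where
    open ≈-Reasoning
    c-zero : c k 0 ≈ cst (+ 4) ⊗′ (Z ⊗′ (Z ⊗′ Z ⊗′ Q ⊖′ 1ₛ)) ⊕′ cst (+ 4) ⊗′ (Z ⊗′ (Z ⊗′ Z ⊗′ Q))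
    c-zero = ⊕′-cong (≈-trans (·≈cst⊗′ _ _) (⊗′-cong (≈-refl {cst (+ 4)}) (⊗′-cong Y-zero (⊖′-cong H-zero (≈-refl {1ₛ})))))
                     (≈-trans (·≈cst⊗′ _ _) (⊗′-cong (≈-refl {cst (+ 4)}) (⊗′-cong Y-zero H-zero)))

-- The series V = C₄ + Σ e and U as functions of k

xₑ : ℕ → ℕ → ℕ
xₑ k n = 4 *ₙ k *ₙ n +ₙ 2 *ₙ k +ₙ n *ₙ n +ₙ n

b S : ℕ → ℕ → PS
b k n = q^ (xₑ k n) ⊗′ invPoch k n
S k n = Σfin n (λ i → term k (1 +ₙ i))

u e v : ℕ → ℕ → PS
u k n = sgn n · (z k ⊗′ b k n)
e k n = ⊝′ (sgn n · (z k ⊗′ b k n ⊗′ S k n))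
v k n = (sgn n * ι (2 *ₙ n +ₙ 2)) · b k n ⊕′ e k n

U V : ℕ → PS
U k = Σ∞ (u k)
V k = Σ∞ (v k)

-- The telescoping corrections in the recurrences for u and v.
Gᵤ Gᵥ : ℕ → ℕ → PS
Gᵤ k n = u k (suc n) ⊗′ pochFactor k (suc n)
Gᵥ k n = ⊝′ (sgn n · (q^ (xₑ k n) ⊗′ q^ (2 *ₙ n) ⊗′ q^ 2 ⊗′ z k ⊗′ z k
                      ⊗′ (ι (2 *ₙ n +ₙ 4) · invPoch k n ⊖′ z k ⊗′ (invPoch k n ⊗′ S k n))))

n≤ᵥq^xₑ : ∀ k n → n ≤ᵥ q^ (xₑ k n)
n≤ᵥq^xₑ k n = ≤ᵥ-q^-+ (xₑ k n) _ (exponent k n)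
  where
  exponent : ∀ k n → 4 *ₙ k *ₙ n +ₙ 2 *ₙ k +ₙ n *ₙ n +ₙ n ≡ n +ₙ (4 *ₙ k *ₙ n +ₙ 2 *ₙ k +ₙ n *ₙ n)
  exponent = solve-∀

n≤ᵥb : ∀ k n → n ≤ᵥ b k n
n≤ᵥb k n = ≤ᵥ-⊗′ʳ (invPoch k n) (n≤ᵥq^xₑ k n)

u-summable : ∀ k → Summable (u k)
u-summable k n = ≤ᵥ-· (sgn n) _ (≤ᵥ-⊗′ˡ (z k) (n≤ᵥb k n))

e-summable : ∀ k → Summable (e k)
e-summable k n = ≤ᵥ-⊝′ (≤ᵥ-· (sgn n) _ (≤ᵥ-⊗′ʳ (S k n) (≤ᵥ-⊗′ˡ (z k) (n≤ᵥb k n))))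

v-summable : ∀ k → Summable (v k)
v-summable k n = ≤ᵥ-⊕′ (≤ᵥ-· (sgn n * ι (2 *ₙ n +ₙ 2)) _ (n≤ᵥb k n)) (e-summable k n)

Gᵤ-summable : ∀ k → Summable (Gᵤ k)
Gᵤ-summable k n = ≤ᵥ-⊗′ʳ (pochFactor k (suc n)) (≤ᵥ-mono (ℕ.n≤1+n n) (u-summable k (suc n)))

Gᵥ-summable : ∀ k → Summable (Gᵥ k)
Gᵥ-summable k n = ≤ᵥ-⊝′ (≤ᵥ-· (sgn n) _ (≤ᵥ-⊗′ʳ _ (≤ᵥ-⊗′ʳ (z k) (≤ᵥ-⊗′ʳ (z k) (≤ᵥ-⊗′ʳ (q^ 2) (≤ᵥ-⊗′ʳ (q^ (2 *ₙ n)) (n≤ᵥq^xₑ k n)))))))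

pochFactor⊗term : ∀ k i → pochFactor k (suc i) ⊗′ term k (suc i) ≈ q^ (2 *ₙ suc i)
pochFactor⊗term k i = begin
  pochFactor k (suc i) ⊗′ term k (suc i)
    ≈⟨ ⊗′-cong (≈-trans (⊕′-cong (≈-refl {1ₛ}) (q^-cong (ℕ.+-comm (2 *ₙ k) _))) (⊕′≈⊕ _ _))
               (≈-sym (⊗′≈⊗ (q^ (2 *ₙ suc i)) (inv f))) ⟩
  f ⊗′ (q^ (2 *ₙ suc i) ⊗′ inv f)
    ≈⟨ solve 3 (λ f x I → f :* (x :* I) := x :* (f :* I)) ≈-refl f (q^ (2 *ₙ suc i)) (inv f) ⟩
  q^ (2 *ₙ suc i) ⊗′ (f ⊗′ inv f)
    ≈⟨ ⊗′-cong (≈-refl {q^ (2 *ₙ suc i)}) (inv-inverseʳ f (1⊕-at-0 _ (≤ᵥ-q^-+ _ _ (exponent i k)))) ⟩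
  q^ (2 *ₙ suc i) ⊗′ 1ₛ
    ≈⟨ solve 1 (λ x → x :* con (+ 1) := x) ≈-refl (q^ (2 *ₙ suc i)) ⟩
  q^ (2 *ₙ suc i)
    ∎
  where
  open ≈-Reasoning
  f : PS
  f = 1ₛ ⊕ q^ (2 *ₙ suc i +ₙ 2 *ₙ k)
  exponent : ∀ i k → 2 *ₙ suc i +ₙ 2 *ₙ k ≡ 1 +ₙ (1 +ₙ 2 *ₙ i +ₙ 2 *ₙ k)
  exponent = solve-∀

S-sucₙ : ∀ k n → pochFactor k (suc n) ⊗′ S k (suc n) ≈ pochFactor k (suc n) ⊗′ S k n ⊕′ q^ (2 *ₙ suc n)
S-sucₙ k n = begin
  D ⊗′ S k (suc n)                  ≈⟨ ⊗′-cong (≈-refl {D}) (Σfin-suc n (λ i → term k (1 +ₙ i))) ⟩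
  D ⊗′ (S k n ⊕′ term k (suc n))    ≈⟨ solve 3 (λ D s t → D :* (s :+ t) := D :* s :+ D :* t) ≈-refl D (S k n) (term k (suc n)) ⟩
  D ⊗′ S k n ⊕′ D ⊗′ term k (suc n) ≈⟨ ⊕′-cong (≈-refl {D ⊗′ S k n}) (pochFactor⊗term k n) ⟩
  D ⊗′ S k n ⊕′ q^ (2 *ₙ suc n)     ∎
  where
  open ≈-Reasoning
  D : PS
  D = pochFactor k (suc n)

q^2⊗term : ∀ k i → q^ 2 ⊗′ term (suc k) (suc i) ≈ term k (suc (suc i))
q^2⊗term k i = begin
  q^ 2 ⊗′ (q^ (2 *ₙ suc i) ⊗ J)     ≈⟨ ⊗′-cong (≈-refl {q^ 2}) (≈-sym (⊗′≈⊗ _ _)) ⟩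
  q^ 2 ⊗′ (q^ (2 *ₙ suc i) ⊗′ J)    ≈⟨ solve 3 (λ a b c → a :* (b :* c) := a :* b :* c) ≈-refl (q^ 2) (q^ (2 *ₙ suc i)) J ⟩
  q^ 2 ⊗′ q^ (2 *ₙ suc i) ⊗′ J      ≈⟨ ⊗′-cong (≈-trans (≈-sym (q^-+′ 2 _)) (q^-cong (exponent₁ i))) (inv-cong (⊕-cong (≈-refl {1ₛ}) (q^-cong (exponent₂ k i)))) ⟩
  q^ (2 *ₙ suc (suc i)) ⊗′ inv (1ₛ ⊕ q^ (2 *ₙ suc (suc i) +ₙ 2 *ₙ k))
                                    ≈⟨ ⊗′≈⊗ _ _ ⟩
  term k (suc (suc i))              ∎
  where
  open ≈-Reasoning
  J : PS
  J = inv (1ₛ ⊕ q^ (2 *ₙ suc i +ₙ 2 *ₙ suc k))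
  exponent₁ : ∀ i → 2 +ₙ 2 *ₙ suc i ≡ 2 *ₙ suc (suc i)
  exponent₁ = solve-∀
  exponent₂ : ∀ k i → 2 *ₙ suc i +ₙ 2 *ₙ suc k ≡ 2 *ₙ suc (suc i) +ₙ 2 *ₙ k
  exponent₂ = solve-∀

S-sucₖ : ∀ k n → pochFactor k 1 ⊗′ (q^ 2 ⊗′ S (suc k) n) ⊕′ q^ 2 ≈ pochFactor k 1 ⊗′ S k (suc n)
S-sucₖ k n = begin
  D ⊗′ (q^ 2 ⊗′ S (suc k) n) ⊕′ q^ 2
    ≈⟨ ⊕′-cong (⊗′-cong (≈-refl {D}) (≈-trans (Σfin-⊗′ˡ n (q^ 2) _) (Σfin-cong n (q^2⊗term k)))) (≈-sym (pochFactor⊗term k 0)) ⟩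
  D ⊗′ Σfin n (λ i → term k (2 +ₙ i)) ⊕′ D ⊗′ term k 1
    ≈⟨ solve 3 (λ D s t → D :* s :+ D :* t := D :* (t :+ s)) ≈-refl D (Σfin n (λ i → term k (2 +ₙ i))) (term k 1) ⟩
  D ⊗′ (term k 1 ⊕′ Σfin n (λ i → term k (2 +ₙ i)))
    ≈⟨ ⊗′-cong (≈-refl {D}) (≈-sym (Σfin-head n (λ i → term k (1 +ₙ i)))) ⟩
  D ⊗′ S k (suc n)
    ∎
  where
  open ≈-Reasoning
  D : PS
  D = pochFactor k 1

module _ (k n : ℕ) where
  private
    s X Z W Q I₁ I₂ N S₀ S₁ S′ : PS
    s  = cst (sgn n)
    X  = q^ (xₑ k n)
    Z  = z k
    W  = q^ (2 *ₙ n)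
    Q  = q^ 2
    I₁ = invPoch k (suc n)
    I₂ = invPoch k (suc (suc n))
    N  = cst (ι n)
    S₀ = S k n
    S₁ = S k (suc n)
    S′ = S (suc k) n

    X₁ Xₖ X₂ D₁ D₂ Dₖ : PS
    X₁ = X ⊗′ Z ⊗′ Z ⊗′ W ⊗′ Q
    Xₖ = X ⊗′ W ⊗′ W ⊗′ Q
    X₂ = X ⊗′ Z ⊗′ Z ⊗′ Z ⊗′ Z ⊗′ W ⊗′ W ⊗′ Q ⊗′ Q ⊗′ Q
    D₁ = 1ₛ ⊕′ Z ⊗′ W ⊗′ Q
    D₂ = 1ₛ ⊕′ Z ⊗′ W ⊗′ Q ⊗′ Q
    Dₖ = 1ₛ ⊕′ Z ⊗′ Q

    X-sucₙ : q^ (xₑ k (suc n)) ≈ X₁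
    X-sucₙ = q^-∑ (xₑ k n) (2 *ₙ k ∷ 2 *ₙ k ∷ 2 *ₙ n ∷ 2 ∷ []) (exponent k n)
      where
      exponent : ∀ k n → 4 *ₙ k *ₙ suc n +ₙ 2 *ₙ k +ₙ suc n *ₙ suc n +ₙ suc n
                       ≡ 4 *ₙ k *ₙ n +ₙ 2 *ₙ k +ₙ n *ₙ n +ₙ n +ₙ 2 *ₙ k +ₙ 2 *ₙ k +ₙ 2 *ₙ n +ₙ 2
      exponent = solve-∀

    X-sucₖ : q^ (xₑ (suc k) n) ≈ Xₖ
    X-sucₖ = q^-∑ (xₑ k n) (2 *ₙ n ∷ 2 *ₙ n ∷ 2 ∷ []) (exponent k n)
      where
      exponent : ∀ k n → 4 *ₙ suc k *ₙ n +ₙ 2 *ₙ suc k +ₙ n *ₙ n +ₙ n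
                       ≡ 4 *ₙ k *ₙ n +ₙ 2 *ₙ k +ₙ n *ₙ n +ₙ n +ₙ 2 *ₙ n +ₙ 2 *ₙ n +ₙ 2
      exponent = solve-∀

    X-suc-sucₙ : q^ (xₑ k (suc (suc n))) ≈ X₂
    X-suc-sucₙ = q^-∑ (xₑ k n) (2 *ₙ k ∷ 2 *ₙ k ∷ 2 *ₙ k ∷ 2 *ₙ k ∷ 2 *ₙ n ∷ 2 *ₙ n ∷ 2 ∷ 2 ∷ 2 ∷ []) (exponent k n)
      where
      exponent : ∀ k n → 4 *ₙ k *ₙ suc (suc n) +ₙ 2 *ₙ k +ₙ suc (suc n) *ₙ suc (suc n) +ₙ suc (suc n)
                       ≡ 4 *ₙ k *ₙ n +ₙ 2 *ₙ k +ₙ n *ₙ n +ₙ n +ₙ 2 *ₙ k +ₙ 2 *ₙ k +ₙ 2 *ₙ k +ₙ 2 *ₙ k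
                         +ₙ 2 *ₙ n +ₙ 2 *ₙ n +ₙ 2 +ₙ 2 +ₙ 2
      exponent = solve-∀

    pochFactor-suc : pochFactor k (suc n) ≈ D₁
    pochFactor-suc = ⊕′-cong (≈-refl {1ₛ}) (q^-∑ (2 *ₙ k) (2 *ₙ n ∷ 2 ∷ []) (exponent k n))
      where
      exponent : ∀ k n → 2 *ₙ k +ₙ 2 *ₙ suc n ≡ 2 *ₙ k +ₙ 2 *ₙ n +ₙ 2
      exponent = solve-∀

    pochFactor-suc-suc : pochFactor k (suc (suc n)) ≈ D₂
    pochFactor-suc-suc = ⊕′-cong (≈-refl {1ₛ}) (q^-∑ (2 *ₙ k) (2 *ₙ n ∷ 2 ∷ 2 ∷ []) (exponent k n))
      where
      exponent : ∀ k n → 2 *ₙ k +ₙ 2 *ₙ suc (suc n) ≡ 2 *ₙ k +ₙ 2 *ₙ n +ₙ 2 +ₙ 2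
      exponent = solve-∀

    W-suc : q^ (2 *ₙ suc n) ≈ W ⊗′ Q
    W-suc = q^-∑ (2 *ₙ n) (2 ∷ []) (trans (ℕ.*-suc 2 n) (ℕ.+-comm 2 (2 *ₙ n)))

    I₀-atoms : invPoch k n ≈ D₁ ⊗′ I₁
    I₀-atoms = ≈-trans (invPoch-suc k n) (⊗′-cong pochFactor-suc (≈-refl {I₁}))

    I₁-atoms : I₁ ≈ D₂ ⊗′ I₂
    I₁-atoms = ≈-trans (invPoch-suc k (suc n)) (⊗′-cong pochFactor-suc-suc (≈-refl {I₂}))

    Iₖ-atoms : invPoch (suc k) n ≈ Dₖ ⊗′ I₁
    Iₖ-atoms = ≈-trans (invPoch-sucᵏ k n) (⊗′-cong (pochFactor-1 k) (≈-refl {I₁}))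

    u-sucₙ-atoms : u k (suc n) ≈ ⊝′ s ⊗′ (Z ⊗′ (X₁ ⊗′ I₁))
    u-sucₙ-atoms = ≈-trans (·≈cst⊗′ _ _) (⊗′-cong (cst-sgn-suc n) (⊗′-cong (≈-refl {Z}) (⊗′-cong X-sucₙ (≈-refl {I₁}))))

    u-sucₖ-atoms : u (suc k) n ≈ s ⊗′ ((Z ⊗′ Q) ⊗′ (Xₖ ⊗′ (Dₖ ⊗′ I₁)))
    u-sucₖ-atoms = ≈-trans (·≈cst⊗′ _ _) (⊗′-cong (≈-refl {s}) (⊗′-cong (z-suc k) (⊗′-cong X-sucₖ Iₖ-atoms)))

    u-suc-sucₙ-atoms : u k (suc (suc n)) ≈ s ⊗′ (Z ⊗′ (X₂ ⊗′ I₂))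
    u-suc-sucₙ-atoms = ≈-trans (·≈cst⊗′ _ _)
      (⊗′-cong (cst-cong (sgn-suc-suc n)) (⊗′-cong (≈-refl {Z}) (⊗′-cong X-suc-sucₙ (≈-refl {I₂}))))

  u-sucₙ : u k (suc n) ≈ Z ⊗′ Z ⊗′ Z ⊗′ u (suc k) n ⊕′ (Gᵤ k n ⊖′ Gᵤ k (suc n))
  u-sucₙ = begin
    u k (suc n)
      ≈⟨ ≈-trans u-sucₙ-atoms (⊗′-cong (≈-refl {⊝′ s}) (⊗′-cong (≈-refl {Z}) (⊗′-cong (≈-refl {X₁}) I₁-atoms))) ⟩
    ⊝′ s ⊗′ (Z ⊗′ (X₁ ⊗′ (D₂ ⊗′ I₂)))
      ≈⟨ solve 6 (λ s X Z W Q I₂ →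
           let X₁ = X :* Z :* Z :* W :* Q
               Xₖ = X :* W :* W :* Q
               X₂ = X :* Z :* Z :* Z :* Z :* W :* W :* Q :* Q :* Q
               D₁ = con (+ 1) :+ Z :* W :* Q
               D₂ = con (+ 1) :+ Z :* W :* Q :* Q
               Dₖ = con (+ 1) :+ Z :* Q
           in :- s :* (Z :* (X₁ :* (D₂ :* I₂)))
              := Z :* Z :* Z :* (s :* ((Z :* Q) :* (Xₖ :* (Dₖ :* (D₂ :* I₂)))))
                 :+ (:- s :* (Z :* (X₁ :* (D₂ :* I₂))) :* D₁ :- s :* (Z :* (X₂ :* I₂)) :* D₂))
           ≈-refl s X Z W Q I₂ ⟩
    Z ⊗′ Z ⊗′ Z ⊗′ (s ⊗′ ((Z ⊗′ Q) ⊗′ (Xₖ ⊗′ (Dₖ ⊗′ (D₂ ⊗′ I₂)))))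
      ⊕′ (⊝′ s ⊗′ (Z ⊗′ (X₁ ⊗′ (D₂ ⊗′ I₂))) ⊗′ D₁ ⊖′ s ⊗′ (Z ⊗′ (X₂ ⊗′ I₂)) ⊗′ D₂)
      ≈⟨ ≈-sym (⊕′-cong (⊗′-cong (≈-refl {Z ⊗′ Z ⊗′ Z}) (≈-trans u-sucₖ-atoms (⊗′-cong (≈-refl {s})
                          (⊗′-cong (≈-refl {Z ⊗′ Q}) (⊗′-cong (≈-refl {Xₖ}) (⊗′-cong (≈-refl {Dₖ}) I₁-atoms))))))
                        (⊖′-cong (⊗′-cong (≈-trans u-sucₙ-atoms (⊗′-cong (≈-refl {⊝′ s}) (⊗′-cong (≈-refl {Z})
                                                 (⊗′-cong (≈-refl {X₁}) I₁-atoms)))) pochFactor-suc)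
                                 (⊗′-cong u-suc-sucₙ-atoms pochFactor-suc-suc))) ⟩
    Z ⊗′ Z ⊗′ Z ⊗′ u (suc k) n ⊕′ (Gᵤ k n ⊖′ Gᵤ k (suc n))
      ∎
    where open ≈-Reasoning

  private
    S-sucₙ-atoms : D₁ ⊗′ S₁ ≈ D₁ ⊗′ S₀ ⊕′ W ⊗′ Q
    S-sucₙ-atoms = ≈-trans (⊗′-cong (≈-sym pochFactor-suc) (≈-refl {S₁}))
                           (≈-trans (S-sucₙ k n) (⊕′-cong (⊗′-cong pochFactor-suc (≈-refl {S₀})) W-suc))

    S-sucₖ-atoms : Dₖ ⊗′ (Q ⊗′ S′) ⊕′ Q ≈ Dₖ ⊗′ S₁
    S-sucₖ-atoms = ≈-trans (⊕′-cong (⊗′-cong (≈-sym (pochFactor-1 k)) (≈-refl {Q ⊗′ S′})) (≈-refl {Q}))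
                           (≈-trans (S-sucₖ k n) (⊗′-cong (pochFactor-1 k) (≈-refl {S₁})))

    v-sucₙ-atoms : v k (suc n) ≈ ⊝′ s ⊗′ ((cst (+ 2) ⊗′ N ⊕′ cst (+ 4)) ⊗′ (X₁ ⊗′ I₁))
                                 ⊕′ ⊝′ (⊝′ s ⊗′ (Z ⊗′ (X₁ ⊗′ I₁) ⊗′ S₁))
    v-sucₙ-atoms = ⊕′-cong
      (≈-trans (·-* _ _ _) (⊗′-cong (cst-sgn-suc n) (⊗′-cong (cst-ι-affine 2 n 4 (exponent n)) (⊗′-cong X-sucₙ (≈-refl {I₁})))))
      (⊝′-cong (≈-trans (·≈cst⊗′ _ _)
        (⊗′-cong (cst-sgn-suc n) (⊗′-cong (⊗′-cong (≈-refl {Z}) (⊗′-cong X-sucₙ (≈-refl {I₁}))) (≈-refl {S₁})))))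
      where
      exponent : ∀ n → 2 *ₙ suc n +ₙ 2 ≡ 2 *ₙ n +ₙ 4
      exponent = solve-∀

    v-sucₖ-atoms : v (suc k) n ≈ s ⊗′ ((cst (+ 2) ⊗′ N ⊕′ cst (+ 2)) ⊗′ (Xₖ ⊗′ (Dₖ ⊗′ I₁)))
                                 ⊕′ ⊝′ (s ⊗′ ((Z ⊗′ Q) ⊗′ (Xₖ ⊗′ (Dₖ ⊗′ I₁)) ⊗′ S′))
    v-sucₖ-atoms = ⊕′-cong
      (≈-trans (·-* _ _ _) (⊗′-cong (≈-refl {s}) (⊗′-cong (cst-ι-affine 2 n 2 refl) (⊗′-cong X-sucₖ Iₖ-atoms))))
      (⊝′-cong (≈-trans (·≈cst⊗′ _ _)
        (⊗′-cong (≈-refl {s}) (⊗′-cong (⊗′-cong (z-suc k) (⊗′-cong X-sucₖ Iₖ-atoms)) (≈-refl {S′})))))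

    Gᵥ-atoms : Gᵥ k n ≈ ⊝′ (s ⊗′ (X ⊗′ W ⊗′ Q ⊗′ Z ⊗′ Z
                                  ⊗′ ((cst (+ 2) ⊗′ N ⊕′ cst (+ 4)) ⊗′ (D₁ ⊗′ I₁) ⊖′ Z ⊗′ ((D₁ ⊗′ I₁) ⊗′ S₀))))
    Gᵥ-atoms = ⊝′-cong (≈-trans (·≈cst⊗′ _ _) (⊗′-cong (≈-refl {s}) (⊗′-cong (≈-refl {X ⊗′ W ⊗′ Q ⊗′ Z ⊗′ Z})
      (⊖′-cong (≈-trans (·≈cst⊗′ _ _) (⊗′-cong (cst-ι-affine 2 n 4 refl) I₀-atoms))
               (⊗′-cong (≈-refl {Z}) (⊗′-cong I₀-atoms (≈-refl {S₀})))))))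

    Gᵥ-suc-atoms : Gᵥ k (suc n) ≈ ⊝′ (⊝′ s ⊗′ (X₁ ⊗′ (W ⊗′ Q) ⊗′ Q ⊗′ Z ⊗′ Z
                                              ⊗′ ((cst (+ 2) ⊗′ N ⊕′ cst (+ 6)) ⊗′ I₁ ⊖′ Z ⊗′ (I₁ ⊗′ S₁))))
    Gᵥ-suc-atoms = ⊝′-cong (≈-trans (·≈cst⊗′ _ _) (⊗′-cong (cst-sgn-suc n)
      (⊗′-cong (⊗′-cong (⊗′-cong (⊗′-cong (⊗′-cong X-sucₙ W-suc) (≈-refl {Q})) (≈-refl {Z})) (≈-refl {Z}))
               (⊖′-cong (≈-trans (·≈cst⊗′ _ _) (⊗′-cong (cst-ι-affine 2 n 6 (exponent n)) (≈-refl {I₁})))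
                        (≈-refl {Z ⊗′ (I₁ ⊗′ S₁)})))))
      where
      exponent : ∀ n → 2 *ₙ suc n +ₙ 4 ≡ 2 *ₙ n +ₙ 6
      exponent = solve-∀

  -- The identity holds modulo the two recursions of the inner sums S.
  v-sucₙ : v k (suc n) ≈ cst (+ 3) ⊗′ (Z ⊗′ Z) ⊗′ u (suc k) n ⊕′ Z ⊗′ Z ⊗′ Z ⊗′ Q ⊗′ v (suc k) n
                         ⊕′ (Gᵥ k n ⊖′ Gᵥ k (suc n))
  v-sucₙ = begin
    v k (suc n)
      ≈⟨ v-sucₙ-atoms ⟩
    ⊝′ s ⊗′ ((cst (+ 2) ⊗′ N ⊕′ cst (+ 4)) ⊗′ (X₁ ⊗′ I₁)) ⊕′ ⊝′ (⊝′ s ⊗′ (Z ⊗′ (X₁ ⊗′ I₁) ⊗′ S₁))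
      ≈⟨ ≈-mod (≈-mod (solve 10 (λ s N X Z W Q I₁ S₀ S₁ S′ →
           let D₁ = con (+ 1) :+ Z :* W :* Q
               Dₖ = con (+ 1) :+ Z :* Q
               X₁ = X :* Z :* Z :* W :* Q
               Xₖ = X :* W :* W :* Q
           in :- s :* ((con (+ 2) :* N :+ con (+ 4)) :* (X₁ :* I₁)) :+ :- (:- s :* (Z :* (X₁ :* I₁) :* S₁))
              := (con (+ 3) :* (Z :* Z) :* (s :* ((Z :* Q) :* (Xₖ :* (Dₖ :* I₁))))
                  :+ Z :* Z :* Z :* Q :* (s :* ((con (+ 2) :* N :+ con (+ 2)) :* (Xₖ :* (Dₖ :* I₁)))
                                          :+ :- (s :* ((Z :* Q) :* (Xₖ :* (Dₖ :* I₁)) :* S′)))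
                  :+ (:- (s :* (X :* W :* Q :* Z :* Z :* ((con (+ 2) :* N :+ con (+ 4)) :* (D₁ :* I₁)
                                                           :- Z :* ((D₁ :* I₁) :* S₀))))
                      :- :- (:- s :* (X₁ :* (W :* Q) :* Q :* Z :* Z :* ((con (+ 2) :* N :+ con (+ 6)) :* I₁
                                                                         :- Z :* (I₁ :* S₁)))))
                  :+ (s :* X :* W :* Q :* Z :* Z :* Z :* I₁) :* (D₁ :* S₁ :- (D₁ :* S₀ :+ W :* Q)))
                 :+ (s :* Z :* Z :* Z :* Z :* Q :* Q :* X :* W :* W :* I₁) :* (Dₖ :* (Q :* S′) :+ Q :- Dₖ :* S₁))
           ≈-refl s N X Z W Q I₁ S₀ S₁ S′) S-sucₖ-atoms) S-sucₙ-atoms ⟩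
    cst (+ 3) ⊗′ (Z ⊗′ Z) ⊗′ (s ⊗′ ((Z ⊗′ Q) ⊗′ (Xₖ ⊗′ (Dₖ ⊗′ I₁))))
      ⊕′ Z ⊗′ Z ⊗′ Z ⊗′ Q ⊗′ (s ⊗′ ((cst (+ 2) ⊗′ N ⊕′ cst (+ 2)) ⊗′ (Xₖ ⊗′ (Dₖ ⊗′ I₁)))
                              ⊕′ ⊝′ (s ⊗′ ((Z ⊗′ Q) ⊗′ (Xₖ ⊗′ (Dₖ ⊗′ I₁)) ⊗′ S′)))
      ⊕′ (⊝′ (s ⊗′ (X ⊗′ W ⊗′ Q ⊗′ Z ⊗′ Z
                    ⊗′ ((cst (+ 2) ⊗′ N ⊕′ cst (+ 4)) ⊗′ (D₁ ⊗′ I₁) ⊖′ Z ⊗′ ((D₁ ⊗′ I₁) ⊗′ S₀))))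
          ⊖′ ⊝′ (⊝′ s ⊗′ (X₁ ⊗′ (W ⊗′ Q) ⊗′ Q ⊗′ Z ⊗′ Z
                           ⊗′ ((cst (+ 2) ⊗′ N ⊕′ cst (+ 6)) ⊗′ I₁ ⊖′ Z ⊗′ (I₁ ⊗′ S₁)))))
      ≈⟨ ≈-sym (⊕′-cong (⊕′-cong (⊗′-cong (≈-refl {cst (+ 3) ⊗′ (Z ⊗′ Z)}) u-sucₖ-atoms)
                                 (⊗′-cong (≈-refl {Z ⊗′ Z ⊗′ Z ⊗′ Q}) v-sucₖ-atoms))
                        (⊖′-cong Gᵥ-atoms Gᵥ-suc-atoms)) ⟩
    cst (+ 3) ⊗′ (Z ⊗′ Z) ⊗′ u (suc k) n ⊕′ Z ⊗′ Z ⊗′ Z ⊗′ Q ⊗′ v (suc k) n ⊕′ (Gᵥ k n ⊖′ Gᵥ k (suc n))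
      ∎
    where open ≈-Reasoning

module _ (k : ℕ) where
  private
    Z Q I₁ : PS
    Z  = z k
    Q  = q^ 2
    I₁ = invPoch k 1

    X-zero : q^ (xₑ k 0) ≈ Z
    X-zero = q^-cong (exponent k)
      where
      exponent : ∀ k → 4 *ₙ k *ₙ 0 +ₙ 2 *ₙ k +ₙ 0 *ₙ 0 +ₙ 0 ≡ 2 *ₙ k
      exponent = solve-∀

    X-one : q^ (xₑ k 1) ≈ Z ⊗′ Z ⊗′ Z ⊗′ Q
    X-one = q^-∑ (2 *ₙ k) (2 *ₙ k ∷ 2 *ₙ k ∷ 2 ∷ []) (exponent k)
      where
      exponent : ∀ k → 4 *ₙ k *ₙ 1 +ₙ 2 *ₙ k +ₙ 1 *ₙ 1 +ₙ 1 ≡ 2 *ₙ k +ₙ 2 *ₙ k +ₙ 2 *ₙ k +ₙ 2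
      exponent = solve-∀


    D⊗I₁≈1 : (1ₛ ⊕′ Z ⊗′ Q) ⊗′ I₁ ≈ 1ₛ
    D⊗I₁≈1 = ≈-trans (⊗′-cong (≈-sym (pochFactor-1 k)) (≈-refl {I₁})) (≈-trans (≈-sym (invPoch-suc k 0)) inv-1)

    S-zero : S k 0 ≈ 0ₛ
    S-zero m = sym (cst-0 m)

  u-zero : u k 0 ⊕′ Gᵤ k 0 ≈ Z ⊗′ Z ⊖′ Z ⊗′ Z ⊗′ Z ⊗′ Z ⊗′ Q
  u-zero = begin
    u k 0 ⊕′ Gᵤ k 0
      ≈⟨ ⊕′-cong (≈-trans (·≈cst⊗′ _ _) (⊗′-cong (≈-refl {1ₛ}) (⊗′-cong (≈-refl {Z}) (⊗′-cong X-zero inv-1))))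
                 (⊗′-cong (≈-trans (·≈cst⊗′ _ _) (⊗′-cong (cst-sgn-suc 0) (⊗′-cong (≈-refl {Z}) (⊗′-cong X-one (≈-refl {I₁}))))) (pochFactor-1 k)) ⟩
    1ₛ ⊗′ (Z ⊗′ (Z ⊗′ 1ₛ)) ⊕′ ⊝′ 1ₛ ⊗′ (Z ⊗′ (Z ⊗′ Z ⊗′ Z ⊗′ Q ⊗′ I₁)) ⊗′ (1ₛ ⊕′ Z ⊗′ Q)
      ≈⟨ ≈-mod (solve 3 (λ Z Q I₁ →
           con (+ 1) :* (Z :* (Z :* con (+ 1))) :+ :- con (+ 1) :* (Z :* (Z :* Z :* Z :* Q :* I₁)) :* (con (+ 1) :+ Z :* Q)
           := (Z :* Z :- Z :* Z :* Z :* Z :* Q) :+ (:- (Z :* Z :* Z :* Z :* Q)) :* ((con (+ 1) :+ Z :* Q) :* I₁ :- con (+ 1)))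
           ≈-refl Z Q I₁) D⊗I₁≈1 ⟩
    Z ⊗′ Z ⊖′ Z ⊗′ Z ⊗′ Z ⊗′ Z ⊗′ Q
      ∎
    where open ≈-Reasoning

  v-zero : v k 0 ⊕′ Gᵥ k 0 ≈ cst (+ 2) ⊗′ Z ⊖′ cst (+ 4) ⊗′ (Z ⊗′ Z ⊗′ Z ⊗′ Q)
  v-zero = begin
    v k 0 ⊕′ Gᵥ k 0
      ≈⟨ ⊕′-cong (⊕′-cong (≈-trans (·≈cst⊗′ _ _) (⊗′-cong (≈-refl {cst (+ 2)}) (⊗′-cong X-zero inv-1)))
                          (⊝′-cong (≈-trans (·≈cst⊗′ _ _) (⊗′-cong (≈-refl {1ₛ}) (⊗′-cong (⊗′-cong (≈-refl {Z}) (⊗′-cong X-zero inv-1)) S-zero)))))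
                 (⊝′-cong (≈-trans (·≈cst⊗′ _ _) (⊗′-cong (≈-refl {1ₛ}) (⊗′-cong (⊗′-cong (⊗′-cong (⊗′-cong (⊗′-cong X-zero q^-0) (≈-refl {Q})) (≈-refl {Z})) (≈-refl {Z}))
                   (⊖′-cong (≈-trans (·≈cst⊗′ _ _) (⊗′-cong (≈-refl {cst (+ 4)}) inv-1)) (⊗′-cong (≈-refl {Z}) (⊗′-cong inv-1 S-zero))))))) ⟩
    cst (+ 2) ⊗′ (Z ⊗′ 1ₛ) ⊕′ ⊝′ (1ₛ ⊗′ (Z ⊗′ (Z ⊗′ 1ₛ) ⊗′ 0ₛ))
      ⊕′ ⊝′ (1ₛ ⊗′ (Z ⊗′ 1ₛ ⊗′ Q ⊗′ Z ⊗′ Z ⊗′ (cst (+ 4) ⊗′ 1ₛ ⊖′ Z ⊗′ (1ₛ ⊗′ 0ₛ))))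
      ≈⟨ solve 2 (λ Z Q →
           con (+ 2) :* (Z :* con (+ 1)) :+ :- (con (+ 1) :* (Z :* (Z :* con (+ 1)) :* con (+ 0)))
             :+ :- (con (+ 1) :* (Z :* con (+ 1) :* Q :* Z :* Z :* (con (+ 4) :* con (+ 1) :- Z :* (con (+ 1) :* con (+ 0)))))
           := con (+ 2) :* Z :- con (+ 4) :* (Z :* Z :* Z :* Q)) ≈-refl Z Q ⟩
    cst (+ 2) ⊗′ Z ⊖′ cst (+ 4) ⊗′ (Z ⊗′ Z ⊗′ Z ⊗′ Q)
      ∎
    where open ≈-Reasoning

  U-rec : U k ≈ (Z ⊗′ Z ⊖′ Z ⊗′ Z ⊗′ Z ⊗′ Z ⊗′ Q) ⊕′ Z ⊗′ Z ⊗′ Z ⊗′ U (suc k)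
  U-rec = begin
    U k
      ≈⟨ Σ∞-shift-telescope (u k) _ (Gᵤ k) (u-summable k) (Gᵤ-summable k) (u-sucₙ k) ⟩
    (u k 0 ⊕′ Gᵤ k 0) ⊕′ Σ∞ (λ n → Z ⊗′ Z ⊗′ Z ⊗′ u (suc k) n)
      ≈⟨ ⊕′-cong u-zero (≈-sym (Σ∞-⊗′ˡ (Z ⊗′ Z ⊗′ Z) (u (suc k)) (u-summable (suc k)))) ⟩
    (Z ⊗′ Z ⊖′ Z ⊗′ Z ⊗′ Z ⊗′ Z ⊗′ Q) ⊕′ Z ⊗′ Z ⊗′ Z ⊗′ U (suc k)
      ∎
    where open ≈-Reasoning

  V-rec : V k ≈ (cst (+ 2) ⊗′ Z ⊖′ cst (+ 4) ⊗′ (Z ⊗′ Z ⊗′ Z ⊗′ Q))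
                ⊕′ (cst (+ 3) ⊗′ (Z ⊗′ Z) ⊗′ U (suc k) ⊕′ Z ⊗′ Z ⊗′ Z ⊗′ Q ⊗′ V (suc k))
  V-rec = begin
    V k
      ≈⟨ Σ∞-shift-telescope (v k) _ (Gᵥ k) (v-summable k) (Gᵥ-summable k) (v-sucₙ k) ⟩
    (v k 0 ⊕′ Gᵥ k 0) ⊕′ Σ∞ (λ n → cst (+ 3) ⊗′ (Z ⊗′ Z) ⊗′ u (suc k) n ⊕′ Z ⊗′ Z ⊗′ Z ⊗′ Q ⊗′ v (suc k) n)
      ≈⟨ ⊕′-cong v-zero (≈-trans (Σ∞-⊕′ _ _) (⊕′-cong
           (≈-sym (Σ∞-⊗′ˡ (cst (+ 3) ⊗′ (Z ⊗′ Z)) (u (suc k)) (u-summable (suc k))))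
           (≈-sym (Σ∞-⊗′ˡ (Z ⊗′ Z ⊗′ Z ⊗′ Q) (v (suc k)) (v-summable (suc k)))))) ⟩
    (cst (+ 2) ⊗′ Z ⊖′ cst (+ 4) ⊗′ (Z ⊗′ Z ⊗′ Z ⊗′ Q))
      ⊕′ (cst (+ 3) ⊗′ (Z ⊗′ Z) ⊗′ U (suc k) ⊕′ Z ⊗′ Z ⊗′ Z ⊗′ Q ⊗′ V (suc k))
      ∎
    where open ≈-Reasoning

-- Pairing the terms of Σ e

C₁-term C₂-term C₃-term : ℕ → ℕ → PS
C₁-term k j = common k j ⊗ (1ₛ ⊖ q^ (4 *ₙ k +ₙ 4 *ₙ j +ₙ 4)) ⊗ Σfin (2 *ₙ j +ₙ 1) (λ t → term k (1 +ₙ t))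
C₂-term k j = common k j ⊗ q^ (2 *ₙ k +ₙ 4 *ₙ j +ₙ 4) ⊗ Σfin (2 *ₙ j) (λ t → term k (2 +ₙ t))
C₃-term k j = common k j ⊗ q^ (2 *ₙ k +ₙ 4 *ₙ j +ₙ 4)
              ⊗ (q^ 2 ⊗ inv (1ₛ ⊕ q^ (2 *ₙ k +ₙ 2))
                 ⊖ q^ (2 *ₙ k +ₙ 4 *ₙ j +ₙ 4) ⊗ inv (1ₛ ⊕ q^ (2 *ₙ k +ₙ 4 *ₙ j +ₙ 4)))

module _ (k j : ℕ) where
  private
    Z Wq X I Sₒ t₁ tₑ : PS
    Z  = z k
    Wq = q^ (4 *ₙ j +ₙ 4)
    X  = q^ (xₑ k (suc (2 *ₙ j)))
    I  = invPoch k (suc (suc (2 *ₙ j)))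
    Sₒ = S k (suc (2 *ₙ j))
    t₁ = term k 1
    tₑ = term k (suc (suc (2 *ₙ j)))

    e-odd : e k (suc (2 *ₙ j)) ≈ ⊝′ (⊝′ 1ₛ ⊗′ (Z ⊗′ (X ⊗′ ((1ₛ ⊕′ Z ⊗′ Wq) ⊗′ I)) ⊗′ Sₒ))
    e-odd = ⊝′-cong (≈-trans (·≈cst⊗′ _ _) (⊗′-cong sign (⊗′-cong (⊗′-cong (≈-refl {Z}) (⊗′-cong (≈-refl {X}) I-odd)) (≈-refl {Sₒ}))))
      where
      sign : cst (sgn (suc (2 *ₙ j))) ≈ ⊝′ 1ₛ
      sign = ≈-trans (cst-sgn-suc (2 *ₙ j)) (⊝′-cong (cst-cong (sgn-even j)))
      exponent : ∀ k j → 2 *ₙ k +ₙ 2 *ₙ suc (suc (2 *ₙ j)) ≡ 2 *ₙ k +ₙ (4 *ₙ j +ₙ 4)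
      exponent = solve-∀
      I-odd : invPoch k (suc (2 *ₙ j)) ≈ (1ₛ ⊕′ Z ⊗′ Wq) ⊗′ I
      I-odd = ≈-trans (invPoch-suc k (suc (2 *ₙ j)))
                      (⊗′-cong (⊕′-cong (≈-refl {1ₛ}) (q^-∑ (2 *ₙ k) (4 *ₙ j +ₙ 4 ∷ []) (exponent k j))) (≈-refl {I}))

    e-even : e k (suc (suc (2 *ₙ j))) ≈ ⊝′ (1ₛ ⊗′ (Z ⊗′ (X ⊗′ Z ⊗′ Z ⊗′ Wq ⊗′ I) ⊗′ (Sₒ ⊕′ tₑ)))
    e-even = ⊝′-cong (≈-trans (·≈cst⊗′ _ _) (⊗′-cong sign
               (⊗′-cong (⊗′-cong (≈-refl {Z}) (⊗′-cong X-even (≈-refl {I}))) (Σfin-suc (suc (2 *ₙ j)) (λ i → term k (1 +ₙ i))))))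
      where
      sign : cst (sgn (suc (suc (2 *ₙ j)))) ≈ 1ₛ
      sign = cst-cong (trans (sgn-suc-suc (2 *ₙ j)) (sgn-even j))
      exponent : ∀ k j → 4 *ₙ k *ₙ suc (suc (2 *ₙ j)) +ₙ 2 *ₙ k +ₙ suc (suc (2 *ₙ j)) *ₙ suc (suc (2 *ₙ j)) +ₙ suc (suc (2 *ₙ j))
                       ≡ 4 *ₙ k *ₙ suc (2 *ₙ j) +ₙ 2 *ₙ k +ₙ suc (2 *ₙ j) *ₙ suc (2 *ₙ j) +ₙ suc (2 *ₙ j)
                         +ₙ 2 *ₙ k +ₙ 2 *ₙ k +ₙ (4 *ₙ j +ₙ 4)
      exponent = solve-∀
      X-even : q^ (xₑ k (suc (suc (2 *ₙ j)))) ≈ X ⊗′ Z ⊗′ Z ⊗′ Wq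
      X-even = q^-∑ (xₑ k (suc (2 *ₙ j))) (2 *ₙ k ∷ 2 *ₙ k ∷ 4 *ₙ j +ₙ 4 ∷ []) (exponent k j)

    common-atoms : common k j ≈ Z ⊗′ X ⊗′ I
    common-atoms = ⊗-cong′ (q^-∑ (2 *ₙ k) (xₑ k (suc (2 *ₙ j)) ∷ []) (exponent k j))
                           (≡⇒≈ (cong (invPoch k) (ℕ.+-comm (2 *ₙ j) 2)))
      where
      exponent : ∀ k j → 8 *ₙ k *ₙ j +ₙ 8 *ₙ k +ₙ 4 *ₙ j *ₙ j +ₙ 6 *ₙ j +ₙ 2
                       ≡ 2 *ₙ k +ₙ (4 *ₙ k *ₙ suc (2 *ₙ j) +ₙ 2 *ₙ k +ₙ suc (2 *ₙ j) *ₙ suc (2 *ₙ j) +ₙ suc (2 *ₙ j))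
      exponent = solve-∀

    ZWq : q^ (2 *ₙ k +ₙ 4 *ₙ j +ₙ 4) ≈ Z ⊗′ Wq
    ZWq = q^-∑ (2 *ₙ k) (4 *ₙ j +ₙ 4 ∷ []) (ℕ.+-assoc (2 *ₙ k) (4 *ₙ j) 4)

    C₁-atoms : C₁-term k j ≈ Z ⊗′ X ⊗′ I ⊗′ (1ₛ ⊖′ Z ⊗′ Z ⊗′ Wq) ⊗′ Sₒ
    C₁-atoms = ⊗-cong′ (⊗-cong′ common-atoms (⊖-cong′ (≈-refl {1ₛ}) (q^-∑ (2 *ₙ k) (2 *ₙ k ∷ 4 *ₙ j +ₙ 4 ∷ []) (exponent k j))))
                       (≡⇒≈ (cong (λ i → Σfin i (λ t → term k (1 +ₙ t))) (ℕ.+-comm (2 *ₙ j) 1)))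
      where
      exponent : ∀ k j → 4 *ₙ k +ₙ 4 *ₙ j +ₙ 4 ≡ 2 *ₙ k +ₙ 2 *ₙ k +ₙ (4 *ₙ j +ₙ 4)
      exponent = solve-∀

    C₂-atoms : C₂-term k j ≈ Z ⊗′ X ⊗′ I ⊗′ (Z ⊗′ Wq) ⊗′ (Sₒ ⊖′ t₁)
    C₂-atoms = ⊗-cong′ (⊗-cong′ common-atoms ZWq) (begin
      Σfin (2 *ₙ j) (λ t → term k (2 +ₙ t))
        ≈⟨ solve 2 (λ t₁ x → x := t₁ :+ x :- t₁) ≈-refl t₁ (Σfin (2 *ₙ j) (λ t → term k (2 +ₙ t))) ⟩
      t₁ ⊕′ Σfin (2 *ₙ j) (λ t → term k (2 +ₙ t)) ⊖′ t₁
        ≈⟨ ⊖′-cong (≈-sym (Σfin-head (2 *ₙ j) (λ t → term k (1 +ₙ t)))) (≈-refl {t₁}) ⟩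
      Sₒ ⊖′ t₁
        ∎)
      where open ≈-Reasoning

    C₃-atoms : C₃-term k j ≈ Z ⊗′ X ⊗′ I ⊗′ (Z ⊗′ Wq) ⊗′ (t₁ ⊖′ Z ⊗′ tₑ)
    C₃-atoms = ⊗-cong′ (⊗-cong′ common-atoms ZWq) (⊖-cong′ first (≈-trans (⊗-cong′ ZWq last-inv) (assoc)))
      where
      first : q^ 2 ⊗ inv (1ₛ ⊕ q^ (2 *ₙ k +ₙ 2)) ≈ t₁
      first = ⊗-cong (≈-refl {q^ 2}) (inv-cong (⊕-cong (≈-refl {1ₛ}) (q^-cong (ℕ.+-comm (2 *ₙ k) 2))))
      exponent : ∀ k j → 2 *ₙ k +ₙ 4 *ₙ j +ₙ 4 ≡ 2 *ₙ suc (suc (2 *ₙ j)) +ₙ 2 *ₙ k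
      exponent = solve-∀
      last-inv : inv (1ₛ ⊕ q^ (2 *ₙ k +ₙ 4 *ₙ j +ₙ 4)) ≈ inv (1ₛ ⊕ q^ (2 *ₙ suc (suc (2 *ₙ j)) +ₙ 2 *ₙ k))
      last-inv = inv-cong (⊕-cong (≈-refl {1ₛ}) (q^-cong (exponent k j)))
      assoc : Z ⊗′ Wq ⊗′ inv (1ₛ ⊕ q^ (2 *ₙ suc (suc (2 *ₙ j)) +ₙ 2 *ₙ k)) ≈ Z ⊗′ tₑ
      assoc = ≈-trans (solve 3 (λ a b c → a :* b :* c := a :* (b :* c)) ≈-refl Z Wq J)
                      (⊗′-cong (≈-refl {Z}) (≈-trans (⊗′-cong (q^-cong (exponent₂ j)) (≈-refl {J})) (⊗′≈⊗ _ _)))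
        where
        J : PS
        J = inv (1ₛ ⊕ q^ (2 *ₙ suc (suc (2 *ₙ j)) +ₙ 2 *ₙ k))
        exponent₂ : ∀ j → 4 *ₙ j +ₙ 4 ≡ 2 *ₙ suc (suc (2 *ₙ j))
        exponent₂ = solve-∀

  e-pair : e k (suc (2 *ₙ j)) ⊕′ e k (suc (suc (2 *ₙ j))) ≈ C₁-term k j ⊕ C₂-term k j ⊕ C₃-term k j
  e-pair = begin
    e k (suc (2 *ₙ j)) ⊕′ e k (suc (suc (2 *ₙ j)))
      ≈⟨ ⊕′-cong e-odd e-even ⟩
    ⊝′ (⊝′ 1ₛ ⊗′ (Z ⊗′ (X ⊗′ ((1ₛ ⊕′ Z ⊗′ Wq) ⊗′ I)) ⊗′ Sₒ)) ⊕′ ⊝′ (1ₛ ⊗′ (Z ⊗′ (X ⊗′ Z ⊗′ Z ⊗′ Wq ⊗′ I) ⊗′ (Sₒ ⊕′ tₑ)))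
      ≈⟨ solve 7 (λ Z Wq X I Sₒ t₁ tₑ →
           :- (:- con (+ 1) :* (Z :* (X :* ((con (+ 1) :+ Z :* Wq) :* I)) :* Sₒ))
             :+ :- (con (+ 1) :* (Z :* (X :* Z :* Z :* Wq :* I) :* (Sₒ :+ tₑ)))
           := Z :* X :* I :* (con (+ 1) :- Z :* Z :* Wq) :* Sₒ
              :+ Z :* X :* I :* (Z :* Wq) :* (Sₒ :- t₁)
              :+ Z :* X :* I :* (Z :* Wq) :* (t₁ :- Z :* tₑ))
           ≈-refl Z Wq X I Sₒ t₁ tₑ ⟩
    Z ⊗′ X ⊗′ I ⊗′ (1ₛ ⊖′ Z ⊗′ Z ⊗′ Wq) ⊗′ Sₒ ⊕′ Z ⊗′ X ⊗′ I ⊗′ (Z ⊗′ Wq) ⊗′ (Sₒ ⊖′ t₁)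
      ⊕′ Z ⊗′ X ⊗′ I ⊗′ (Z ⊗′ Wq) ⊗′ (t₁ ⊖′ Z ⊗′ tₑ)
      ≈⟨ ≈-sym (⊕-cong′ (⊕-cong′ C₁-atoms C₂-atoms) C₃-atoms) ⟩
    C₁-term k j ⊕ C₂-term k j ⊕ C₃-term k j
      ∎
    where open ≈-Reasoning

Σe≈C₁+C₂+C₃ : ∀ k → Σ∞ (e k) ≈ C₁ k ⊕ C₂ k ⊕ C₃ k
Σe≈C₁+C₂+C₃ k = begin
  Σ∞ (e k)                                                        ≈⟨ Σ∞-pairs (e k) (e-summable k) e-zero ⟩
  Σ∞ (λ j → e k (suc (2 *ₙ j)) ⊕′ e k (suc (suc (2 *ₙ j))))       ≈⟨ Σ∞-cong (e-pair k) ⟩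
  Σ∞ (λ j → C₁-term k j ⊕ C₂-term k j ⊕ C₃-term k j)              ≈⟨ Σ∞-⊕ _ (C₃-term k) ⟩
  Σ∞ (λ j → C₁-term k j ⊕ C₂-term k j) ⊕ C₃ k                     ≈⟨ ⊕-cong (Σ∞-⊕ (C₁-term k) (C₂-term k)) (≈-refl {C₃ k}) ⟩
  C₁ k ⊕ C₂ k ⊕ C₃ k                                              ∎
  where
  open ≈-Reasoning
  e-zero : e k 0 ≈ 0ₛ
  e-zero = ≈-trans (⊝′-cong (≈-trans (·≈cst⊗′ _ _) (⊗′-cong (≈-refl {1ₛ}) (⊗′-cong (≈-refl {z k ⊗′ b k 0}) (λ m → sym (cst-0 m))))))
                   (solve 1 (λ x → :- (con (+ 1) :* (x :* con (+ 0))) := con (+ 0)) ≈-refl (z k ⊗′ b k 0))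

V≈C₄+C₁₂₃ : ∀ k → V k ≈ C₄ k ⊕′ (C₁ k ⊕ C₂ k ⊕ C₃ k)
V≈C₄+C₁₂₃ k = begin
  V k                        ≈⟨ Σ∞-⊕′ _ (e k) ⟩
  Σ∞ (λ n → (sgn n * ι (2 *ₙ n +ₙ 2)) · b k n) ⊕′ Σ∞ (e k)
    ≈⟨ ⊕′-cong (Σ∞-cong (λ n → ·-cong (sgn n * ι (2 *ₙ n +ₙ 2)) (⊗′≈⊗ (q^ (xₑ k n)) (invPoch k n))))
               (Σe≈C₁+C₂+C₃ k) ⟩
  C₄ k ⊕′ (C₁ k ⊕ C₂ k ⊕ C₃ k) ∎
  where open ≈-Reasoning

-- Descent in k

U+T-rec : ∀ k → U k ⊕′ T k ≈ z k ⊗′ z k ⊗′ z k ⊗′ (U (suc k) ⊕′ T (suc k))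
U+T-rec k = ≈-trans (⊕′-cong (U-rec k) (T-rec k))
  (solve 4 (λ Z Q U T →
     (Z :* Z :- Z :* Z :* Z :* Z :* Q) :+ Z :* Z :* Z :* U :+ (Z :* (Z :* (Z :* Z :* Q :- con (+ 1))) :+ Z :* Z :* Z :* T)
     := Z :* Z :* Z :* (U :+ T))
   ≈-refl (z k) (q^ 2) (U (suc k)) (T (suc k)))

C+2V-rec : ∀ k → C k ⊕′ cst (+ 2) ⊗′ V k ≈ z k ⊗′ z k ⊗′ z k ⊗′ q^ 2 ⊗′ (C (suc k) ⊕′ cst (+ 2) ⊗′ V (suc k))
                                            ⊕′ cst (+ 6) ⊗′ (z k ⊗′ z k) ⊗′ (U (suc k) ⊕′ T (suc k))
C+2V-rec k = ≈-trans (⊕′-cong (C-rec k) (⊗′-cong (≈-refl {cst (+ 2)}) (V-rec k)))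
  (solve 6 (λ Z Q T C U V →
     con (+ 4) :* (Z :* (Z :* Z :* Q :- con (+ 1))) :+ con (+ 4) :* (Z :* (Z :* Z :* Q))
       :+ (con (+ 6) :* (Z :* Z) :* T :+ Z :* Z :* Z :* Q :* C)
       :+ con (+ 2) :* ((con (+ 2) :* Z :- con (+ 4) :* (Z :* Z :* Z :* Q))
                        :+ (con (+ 3) :* (Z :* Z) :* U :+ Z :* Z :* Z :* Q :* V))
     := Z :* Z :* Z :* Q :* (C :+ con (+ 2) :* V) :+ con (+ 6) :* (Z :* Z) :* (U :+ T))
   ≈-refl (z k) (q^ 2) (T (suc k)) (C (suc k)) (U (suc k)) (V (suc k)))

1≤ᵥz : ∀ k → 1 ≤ᵥ z (suc k)
1≤ᵥz k = ≤ᵥ-q^-+ (2 *ₙ suc k) (1 +ₙ 2 *ₙ k) (ℕ.*-suc 2 k)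

U+T≈0 : ∀ k → U (suc k) ⊕′ T (suc k) ≈ 0ₛ
U+T≈0 = descent (λ k → U (suc k) ⊕′ T (suc k)) (λ k → z (suc k) ⊗′ z (suc k) ⊗′ z (suc k))
  (λ k → ≤ᵥ-⊗′ʳ (z (suc k)) (≤ᵥ-⊗′ʳ (z (suc k)) (1≤ᵥz k))) (U+T-rec ∘ suc)

C+2V≈0 : ∀ k → C (suc k) ⊕′ cst (+ 2) ⊗′ V (suc k) ≈ 0ₛ
C+2V≈0 = descent (λ k → C (suc k) ⊕′ cst (+ 2) ⊗′ V (suc k)) (λ k → z (suc k) ⊗′ z (suc k) ⊗′ z (suc k) ⊗′ q^ 2)
  (λ k → ≤ᵥ-⊗′ʳ (q^ 2) (≤ᵥ-⊗′ʳ (z (suc k)) (≤ᵥ-⊗′ʳ (z (suc k)) (1≤ᵥz k))))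
  (λ k → ≈-trans (C+2V-rec (suc k))
           (≈-trans (⊕′-cong ≈-refl (⊗′-cong (≈-refl {cst (+ 6) ⊗′ (z (suc k) ⊗′ z (suc k))}) (U+T≈0 (suc k))))
                    (solve 2 (λ a b → a :+ b :* con (+ 0) := a) ≈-refl _ _)))

-C≈2V : ∀ k → ⊝′ C (suc k) ≈ cst (+ 2) ⊗′ V (suc k)
-C≈2V k = ≈-mod (solve 2 (λ C V → :- C := con (+ 2) :* V :+ :- con (+ 1) :* (C :+ con (+ 2) :* V :- con (+ 0)))
                        ≈-refl (C (suc k)) (V (suc k)))
                (C+2V≈0 k)

lemma4p3 : (k : ℕ) → 1 ≤ k →
    ⊝ C k ≈ (+ 2) · (C₁ k ⊕ C₂ k ⊕ C₃ k ⊕ C₄ k)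
lemma4p3 (suc k) _ = begin
  ⊝ C (suc k)
    ≈⟨ ≈-sym (⊝′≈⊝ (C (suc k))) ⟩
  ⊝′ C (suc k)
    ≈⟨ -C≈2V k ⟩
  cst (+ 2) ⊗′ V (suc k)
    ≈⟨ ⊗′-cong (≈-refl {cst (+ 2)}) (V≈C₄+C₁₂₃ (suc k)) ⟩
  cst (+ 2) ⊗′ (C₄ (suc k) ⊕′ C₁₂₃)
    ≈⟨ solve 2 (λ c₄ c → con (+ 2) :* (c₄ :+ c) := con (+ 2) :* (c :+ c₄)) ≈-refl (C₄ (suc k)) C₁₂₃ ⟩
  cst (+ 2) ⊗′ (C₁₂₃ ⊕′ C₄ (suc k))
    ≈⟨ ⊗′-cong (≈-refl {cst (+ 2)}) (⊕′≈⊕ C₁₂₃ (C₄ (suc k))) ⟩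
  cst (+ 2) ⊗′ (C₁₂₃ ⊕ C₄ (suc k))
    ≈⟨ ≈-sym (·≈cst⊗′ (+ 2) (C₁₂₃ ⊕ C₄ (suc k))) ⟩
  (+ 2) · (C₁₂₃ ⊕ C₄ (suc k))
    ∎
  where
  open ≈-Reasoning
  C₁₂₃ : PS
  C₁₂₃ = C₁ (suc k) ⊕ C₂ (suc k) ⊕ C₃ (suc k)
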